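{- Let $G=(V,E,w)$ be a finite graph with no isolated vertices and positive rational edge weights, with maximum degree $\Delta$. Let $h(A)=\sum_{v\in V}h_A(v)$ where $h_A(v)=W(v)/2$ if $v\in A$ or $W_A(v)\ge W(v)/2$, and $h_A(v)=W_A(v)$ otherwise; let $f(A)=|\{v\in V: N(v)\cap A\neq\emptyset\}|$; and let $g(A)=h(A)+\frac1L f(A)$. Run the greedy algorithm on $U=V$ with potential $g$: start with $S=\emptyset$; while some $u\in V\setminus S$ has $g(S\cup\{u\})-g(S)>0$, add to $S$ a vertex $x\in V\setminus S$ maximizing $g(S\cup\{x\})-g(S)$ (ties arbitrary); then return $S$. Then $S$ is a weighted partial positive influence total dominating set and $|S|\le\big(1+\ln(\tfrac32\cdot L\cdot W+\Delta)\big)\cdot|S^*|$, where $S^*$ is such a set of minimum cardinality.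
   Context: For $v\in V$ and $A\subseteq V$, $W_A(v)=\sum_{u\in N(v)\cap A} w(v,u)$, $W(v)=W_V(v)$, $W=\max_v W(v)$. A set $S$ is a weighted partial positive influence total dominating set (WPPITDS) if every $v\in V\setminus S$ satisfies $W_S(v)\ge W(v)/2$ and every vertex of $S$ has at least one neighbor in $S$. For each vertex $v$ with incident edge weights $w_1,\dots,w_d$, write $W(v)/2=p_0/q_0$, $w_i=p_i/q_i$ as reduced fractions, let $l(v)=\mathrm{lcm}\{q_0,\dots,q_d\}$ and $L=\max_v l(v)$. -}

module Defs where

open import Data.Bool using (Bool; true; false; _∧_; _∨_; if_then_else_; _≟_)
open import Data.Bool.ListAction using (any)
open import Data.Nat as ℕ using (ℕ; zero; suc)
open import Data.Nat.LCM using (lcm)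
open import Data.Integer using (+_)
open import Data.Fin using (Fin)
open import Data.Fin.Subset using (Subset; ⊥; _∈_; _∉_; _∪_; ⁅_⁆; ∣_∣)
open import Data.List using (List; _∷_; map; foldr; filter; length)
open import Data.List.Base using (allFin)
open import Data.Vec using (lookup)
open import Data.Rational using (ℚ; 0ℚ; 1ℚ; ½; _+_; _-_; _*_; _/_; _≤_; _<_; _⊔_; ↧ₙ_)
open import Data.Rational.Properties using (_≤?_)
open import Data.Product using (Σ; _×_)
open import Relation.Nullary using (does)
open import Relation.Binary.PropositionalEquality using (_≡_)

sumℚ : List ℚ → ℚ
sumℚ = foldr _+_ 0ℚ

record WGraph (n : ℕ) : Set where
  field
    adj     : Fin n → Fin n → Bool
    w       : Fin n → Fin n → ℚ
    adj-sym : ∀ u v → adj u v ≡ adj v u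
    adj-irr : ∀ v → adj v v ≡ false
    w-sym   : ∀ u v → w u v ≡ w v u
    w-pos   : ∀ u v → adj u v ≡ true → 0ℚ < w u v

module _ {n : ℕ} (G : WGraph n) where
  open WGraph G

  vertices : List (Fin n)
  vertices = allFin n

  NoIsolated : Set
  NoIsolated = ∀ v → Σ (Fin n) λ u → adj v u ≡ true

  nbrs : Fin n → List (Fin n)
  nbrs v = filter (λ u → adj v u ≟ true) vertices

  deg : Fin n → ℕ
  deg v = length (nbrs v)

  Δ : ℕ
  Δ = foldr ℕ._⊔_ 0 (map deg vertices)

  WA : Subset n → Fin n → ℚ
  WA A v = sumℚ (map (λ u → if lookup A u then w v u else 0ℚ) (nbrs v))

  Wv : Fin n → ℚ
  Wv v = sumℚ (map (w v) (nbrs v))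

  -- W = max_v W(v)   (all W(v) ≥ 0)
  Wmax : ℚ
  Wmax = foldr _⊔_ 0ℚ (map Wv vertices)

  lv : Fin n → ℕ
  lv v = foldr lcm 1 (↧ₙ (½ * Wv v) ∷ map (λ u → ↧ₙ (w v u)) (nbrs v))

  L : ℕ
  L = foldr ℕ._⊔_ 0 (map lv vertices)

  IsWPPITDS : Subset n → Set
  IsWPPITDS S =
    (∀ v → v ∉ S → ½ * Wv v ≤ WA S v) ×
    (∀ v → v ∈ S → Σ (Fin n) λ u → adj v u ≡ true × u ∈ S)

  IsMinWPPITDS : Subset n → Set
  IsMinWPPITDS S = IsWPPITDS S × (∀ T → IsWPPITDS T → ∣ S ∣ ℕ.≤ ∣ T ∣)

  hv : Subset n → Fin n → ℚ
  hv A v = if lookup A v ∨ does (½ * Wv v ≤? WA A v) then ½ * Wv v else WA A v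

  h : Subset n → ℚ
  h A = sumℚ (map (hv A) vertices)

  f : Subset n → ℕ
  f A = length (filter (λ v → any (lookup A) (nbrs v) ≟ true) vertices)

  -- 1/k as a rational (k = 0 never occurs for L on a nonempty graph)
  recipℕ : ℕ → ℚ
  recipℕ zero    = 0ℚ
  recipℕ (suc k) = + 1 / suc k

  g : Subset n → ℚ
  g A = h A + recipℕ L * (+ f A / 1)

  gain : Subset n → Fin n → ℚ
  gain A x = g (A ∪ ⁅ x ⁆) - g A

  data GreedyReach : Subset n → Set where
    start : GreedyReach ⊥
    step  : ∀ {S} x → GreedyReach S → x ∉ S → 0ℚ < gain S x →
            (∀ y → y ∉ S → gain S y ≤ gain S x) →
            GreedyReach (S ∪ ⁅ x ⁆)

  GreedyOutput : Subset n → Set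
  GreedyOutput S = GreedyReach S × (∀ u → u ∉ S → gain S u ≤ 0ℚ)

  Xbound : ℚ
  Xbound = (+ 3 / 2) * ((+ L / 1) * Wmax) + (+ Δ / 1)

expTerm : ℚ → ℕ → ℚ
expTerm y zero    = 1ℚ
expTerm y (suc k) = expTerm y k * y * (+ 1 / suc k)

expPartial : ℚ → ℕ → ℚ
expPartial y zero    = expTerm y zero
expPartial y (suc N) = expPartial y N + expTerm y (suc N)

-- LnBound a b X  expresses  a ≤ (1 + ln X) · b  for naturals a, b and a
-- rational X ≥ 1 (so that ln X ≥ 0), without real numbers:
--  * b = 0 :  a ≤ 0;
--  * b > 0 :  exp((a ∸ b)/b) ≤ X, i.e. every partial sum of the
--             exponential series at (a ∸ b)/b is ≤ X.
-- (When a ≤ b both sides hold trivially since X ≥ 1.)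
LnBound : ℕ → ℕ → ℚ → Set
LnBound a zero    X = a ℕ.≤ 0
LnBound a (suc k) X = ∀ N → expPartial (+ (a ℕ.∸ suc k) / suc k) N ≤ X

-- The potential g(A) = Σ_v h_A(v) + f(A)/L is monotone and submodular, and at each vertex v
-- all its values are multiples of 1/l(v), so every positive gain is at least 1/L. Its maximum
-- Σ_v (W(v)/2 + 1/L) is attained on every WPPITDS, and a set at which no vertex has
-- positive gain is one. For the size bound, submodularity against an optimal S* shows that each
-- greedy step closes the fraction 1/|S*| of the remaining deficit, which initially is at most
-- |S*|·X/L since L times a singleton gain is at most X = (3/2)·L·W + Δ. The last |S*| steps
-- still gain |S*|/L in total, so (1 - 1/|S*|)^(|S| - |S*|)·X ≥ 1, and (1 - 1/k)^j ≤ exp(-j/k)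
-- gives exp((|S| - |S*|)/|S*|) ≤ X.

module Submission where

open import Defs
open import Data.Nat using (ℕ; suc)
open import Data.Fin.Subset using (Subset; ∣_∣)
open import Data.Product using (_×_)

open import Data.Bool as Bool using (Bool; true; false; _∨_; if_then_else_)
import Data.Bool.Properties as Boolₚ
open import Data.Bool.ListAction using (any)
open import Data.Fin as Fin using (Fin; zero; suc)
open import Data.Fin.Subset using (inside; outside; ⊥; _∈_; _∉_; _∪_; ⁅_⁆; _⊆_)
import Data.Fin.Subset.Properties as Subsetₚ
open import Data.Integer as ℤ using (ℤ; +_)
import Data.Integer.Properties as ℤₚ
open import Data.List using (List; []; _∷_; map; foldr; filter; length; allFin)
import Data.List.Properties as Listₚ
open import Data.List.Membership.Propositional using () renaming (_∈_ to _∈ˡ_)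
open import Data.List.Membership.Propositional.Properties using (∈-filter⁺; ∈-filter⁻; ∈-allFin)
import Data.List.Relation.Unary.All as All
open import Data.List.Relation.Unary.AllPairs using (AllPairs; _∷_)
open import Data.List.Relation.Unary.Any using (here; there)
open import Data.List.Relation.Unary.Unique.Propositional.Properties using (allFin⁺)
open import Data.Nat as ℕ using (zero; _∸_)
open import Data.Nat.Divisibility using (_∣_; divides; ∣-trans)
open import Data.Nat.GCD using (gcd)
open import Data.Nat.LCM using (lcm; m∣lcm[m,n]; n∣lcm[m,n]; gcd*lcm)
import Data.Nat.Properties as ℕₚ
open import Data.Product using (Σ; _,_; proj₁; proj₂)
open import Data.Rational as ℚ
  using (ℚ; mkℚ; 0ℚ; 1ℚ; ½; _+_; _-_; _*_; _/_; _≤_; _<_; -_; _⊓_; ↧ₙ_; toℚᵘ; nonNegative; positive)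
import Data.Rational.Properties as ℚₚ
open import Algebra.Definitions.RawSemiring ℚ.+-*-rawSemiring using (_^_)
open import Data.Rational.Solver using (module +-*-Solver)
import Data.Rational.Unnormalised as ℚᵘ
import Data.Rational.Unnormalised.Properties as ℚᵘₚ
open import Data.Sum using (_⊎_; inj₁; inj₂)
open import Data.Vec using ([]; _∷_; here; there; lookup)
import Data.Vec.Properties as Vecₚ
open import Function using (_∘_)
open import Level using (0ℓ)
open import Relation.Binary.PropositionalEquality
open import Relation.Nullary using (Dec; does; yes; no; ¬_; contradiction)
open import Relation.Nullary.Decidable using (dec-true; dec-false)
open import Relation.Unary using (Pred; Decidable)

open +-*-Solver

p≤q⇒0≤q-p : ∀ {p q} → p ≤ q → 0ℚ ≤ q - p
p≤q⇒0≤q-p {p} {q} p≤q = subst (_≤ q - p) (ℚₚ.+-inverseʳ p) (ℚₚ.+-monoˡ-≤ (- p) p≤q)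

p<q⇒0<q-p : ∀ {p q} → p < q → 0ℚ < q - p
p<q⇒0<q-p {p} {q} p<q = subst (_< q - p) (ℚₚ.+-inverseʳ p) (ℚₚ.+-monoˡ-< (- p) p<q)

q-p+p≡q : ∀ p q → q - p + p ≡ q
q-p+p≡q p q = solve 2 (λ p q → q :- p :+ p := q) refl p q

0≤q-p⇒p≤q : ∀ {p q} → 0ℚ ≤ q - p → p ≤ q
0≤q-p⇒p≤q {p} {q} 0≤q-p = subst₂ _≤_ (ℚₚ.+-identityˡ p) (q-p+p≡q p q) (ℚₚ.+-monoˡ-≤ p 0≤q-p)

0≤p*q : ∀ {p q} → 0ℚ ≤ p → 0ℚ ≤ q → 0ℚ ≤ p * q
0≤p*q {p} {q} 0≤p 0≤q = subst (_≤ p * q) (ℚₚ.*-zeroʳ p) (ℚₚ.*-monoˡ-≤-nonNeg p {{nonNegative 0≤p}} 0≤q)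

*-monoˡ-≤-0≤ : ∀ {r p q} → 0ℚ ≤ r → p ≤ q → r * p ≤ r * q
*-monoˡ-≤-0≤ {r} 0≤r = ℚₚ.*-monoˡ-≤-nonNeg r {{nonNegative 0≤r}}

*-monoʳ-≤-0≤ : ∀ {r p q} → 0ℚ ≤ r → p ≤ q → p * r ≤ q * r
*-monoʳ-≤-0≤ {r} 0≤r = ℚₚ.*-monoʳ-≤-nonNeg r {{nonNegative 0≤r}}

*-cancelˡ-≤-0< : ∀ {r p q} → 0ℚ < r → r * p ≤ r * q → p ≤ q
*-cancelˡ-≤-0< {r} 0<r = ℚₚ.*-cancelˡ-≤-pos r {{positive 0<r}}

toℚᵘ-/ : ∀ (i : ℤ) (n : ℕ) → toℚᵘ (i / suc n) ℚᵘ.≃ ℚᵘ.mkℚᵘ i n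
toℚᵘ-/ i n = ℚₚ.toℚᵘ-fromℚᵘ (ℚᵘ.mkℚᵘ i n)

/-≡ : ∀ (i j : ℤ) (m n : ℕ) → i ℤ.* + suc n ≡ j ℤ.* + suc m → i / suc m ≡ j / suc n
/-≡ i j m n eq = ℚₚ.fromℚᵘ-cong {ℚᵘ.mkℚᵘ i m} {ℚᵘ.mkℚᵘ j n} (ℚᵘ.*≡* eq)

/-≤ : ∀ (i j : ℤ) (m n : ℕ) → i ℤ.* + suc n ℤ.≤ j ℤ.* + suc m → i / suc m ≤ j / suc n
/-≤ i j m n le = ℚₚ.toℚᵘ-cancel-≤
  (ℚᵘₚ.≤-respʳ-≃ (ℚᵘₚ.≃-sym (toℚᵘ-/ j n)) (ℚᵘₚ.≤-respˡ-≃ (ℚᵘₚ.≃-sym (toℚᵘ-/ i m)) (ℚᵘ.*≤* le)))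

/-< : ∀ (i j : ℤ) (m n : ℕ) → i ℤ.* + suc n ℤ.< j ℤ.* + suc m → i / suc m < j / suc n
/-< i j m n lt = ℚₚ.toℚᵘ-cancel-<
  (ℚᵘₚ.<-respʳ-≃ (ℚᵘₚ.≃-sym (toℚᵘ-/ j n)) (ℚᵘₚ.<-respˡ-≃ (ℚᵘₚ.≃-sym (toℚᵘ-/ i m)) (ℚᵘ.*<* lt)))

/-<⁻ : ∀ (i j : ℤ) (m n : ℕ) → i / suc m < j / suc n → i ℤ.* + suc n ℤ.< j ℤ.* + suc m
/-<⁻ i j m n lt with ℚᵘₚ.<-respʳ-≃ (toℚᵘ-/ j n) (ℚᵘₚ.<-respˡ-≃ (toℚᵘ-/ i m) (ℚₚ.toℚᵘ-mono-< lt))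
... | ℚᵘ.*<* lt′ = lt′

/-+ : ∀ (i j : ℤ) (n : ℕ) → i / suc n + j / suc n ≡ (i ℤ.+ j) / suc n
/-+ i j n = ℚₚ.toℚᵘ-injective (ℚᵘₚ.≃-trans (ℚₚ.toℚᵘ-homo-+ (i / suc n) (j / suc n))
  (ℚᵘₚ.≃-trans (ℚᵘₚ.+-cong (toℚᵘ-/ i n) (toℚᵘ-/ j n))
  (ℚᵘₚ.≃-trans (ℚᵘ.*≡* cross) (ℚᵘₚ.≃-sym (toℚᵘ-/ (i ℤ.+ j) n)))))
  where
  cross : (i ℤ.* + suc n ℤ.+ j ℤ.* + suc n) ℤ.* + suc n ≡ (i ℤ.+ j) ℤ.* (+ suc n ℤ.* + suc n)
  cross = trans (cong (ℤ._* + suc n) (sym (ℤₚ.*-distribʳ-+ (+ suc n) i j)))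
                (ℤₚ.*-assoc (i ℤ.+ j) (+ suc n) (+ suc n))

/-* : ∀ (i j : ℤ) (m n : ℕ) → (i / suc m) * (j / suc n) ≡ (i ℤ.* j) / (suc m ℕ.* suc n)
/-* i j m n = ℚₚ.toℚᵘ-injective (ℚᵘₚ.≃-trans (ℚₚ.toℚᵘ-homo-* (i / suc m) (j / suc n))
  (ℚᵘₚ.≃-trans (ℚᵘₚ.*-cong (toℚᵘ-/ i m) (toℚᵘ-/ j n))
  (ℚᵘₚ.≃-sym (toℚᵘ-/ (i ℤ.* j) (n ℕ.+ m ℕ.* suc n)))))

ℕ/1-mono-≤ : ∀ {a b} → a ℕ.≤ b → + a / 1 ≤ + b / 1
ℕ/1-mono-≤ {a} {b} a≤b =
  /-≤ (+ a) (+ b) 0 0 (subst₂ ℤ._≤_ (sym (ℤₚ.*-identityʳ (+ a))) (sym (ℤₚ.*-identityʳ (+ b))) (ℤ.+≤+ a≤b))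

ℕ/suc-nonNeg : ∀ j k → 0ℚ ≤ + j / suc k
ℕ/suc-nonNeg j k = /-≤ (+ 0) (+ j) 0 k (subst (ℤ._≤_ (+ 0)) (sym (ℤₚ.*-identityʳ (+ j))) (ℤ.+≤+ ℕ.z≤n))

1/suc-pos : ∀ k → 0ℚ < + 1 / suc k
1/suc-pos k = /-< (+ 0) (+ 1) 0 k (ℤ.+<+ (ℕ.s≤s ℕ.z≤n))

1/suc-nonNeg : ∀ k → 0ℚ ≤ + 1 / suc k
1/suc-nonNeg k = ℚₚ.<⇒≤ (1/suc-pos k)

1/suc≤1 : ∀ k → + 1 / suc k ≤ 1ℚ
1/suc≤1 k = /-≤ (+ 1) (+ 1) k 0 (ℤ.+≤+ (ℕ.s≤s ℕ.z≤n))

suc/1*1/suc≡1 : ∀ k → (+ suc k / 1) * (+ 1 / suc k) ≡ 1ℚ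
suc/1*1/suc≡1 k = trans (/-* (+ suc k) (+ 1) 0 k) (/-≡ (+ suc k ℤ.* + 1) (+ 1) (k ℕ.+ 0 ℕ.* suc k) 0 (cong +_ cross))
  where
  cross : suc k ℕ.* 1 ℕ.* 1 ≡ 1 ℕ.* suc (k ℕ.+ 0 ℕ.* suc k)
  cross = trans (ℕₚ.*-identityʳ _) (trans (ℕₚ.*-identityʳ _)
                (sym (trans (ℕₚ.*-identityˡ _) (cong suc (ℕₚ.+-identityʳ k)))))

ℕ/1+1≡suc/1 : ∀ k → + k / 1 + 1ℚ ≡ + suc k / 1
ℕ/1+1≡suc/1 k = trans (/-+ (+ k) (+ 1) 0) (cong (λ z → + z / 1) (ℕₚ.+-comm k 1))

p-q≤p : ∀ {p q} → 0ℚ ≤ q → p - q ≤ p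
p-q≤p {p} 0≤q = subst (p - _ ≤_) (ℚₚ.+-identityʳ p) (ℚₚ.+-monoʳ-≤ p (ℚₚ.neg-antimono-≤ 0≤q))

p≤p+q : ∀ {p q} → 0ℚ ≤ q → p ≤ p + q
p≤p+q {p} 0≤q = subst (_≤ p + _) (ℚₚ.+-identityʳ p) (ℚₚ.+-monoʳ-≤ p 0≤q)

module _ {A : Set} where

  sum-map-+ : ∀ (φ ψ : A → ℚ) xs →
              sumℚ (map (λ x → φ x + ψ x) xs) ≡ sumℚ (map φ xs) + sumℚ (map ψ xs)
  sum-map-+ φ ψ [] = refl
  sum-map-+ φ ψ (x ∷ xs) rewrite sum-map-+ φ ψ xs =
    solve 4 (λ a b c d → (a :+ b) :+ (c :+ d) := (a :+ c) :+ (b :+ d)) refl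
      (φ x) (ψ x) (sumℚ (map φ xs)) (sumℚ (map ψ xs))

  sum-map-- : ∀ (φ ψ : A → ℚ) xs →
              sumℚ (map (λ x → φ x - ψ x) xs) ≡ sumℚ (map φ xs) - sumℚ (map ψ xs)
  sum-map-- φ ψ [] = refl
  sum-map-- φ ψ (x ∷ xs) rewrite sum-map-- φ ψ xs =
    solve 4 (λ a b c d → (a :- b) :+ (c :- d) := (a :+ c) :- (b :+ d)) refl
      (φ x) (ψ x) (sumℚ (map φ xs)) (sumℚ (map ψ xs))

  sum-map-*ˡ : ∀ c (φ : A → ℚ) xs → sumℚ (map (λ x → c * φ x) xs) ≡ c * sumℚ (map φ xs)
  sum-map-*ˡ c φ [] = sym (ℚₚ.*-zeroʳ c)
  sum-map-*ˡ c φ (x ∷ xs) rewrite sum-map-*ˡ c φ xs = sym (ℚₚ.*-distribˡ-+ c (φ x) (sumℚ (map φ xs)))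

  sum-map-cong : ∀ {φ ψ : A → ℚ} xs → (∀ {x} → x ∈ˡ xs → φ x ≡ ψ x) →
                 sumℚ (map φ xs) ≡ sumℚ (map ψ xs)
  sum-map-cong [] φ≡ψ = refl
  sum-map-cong (x ∷ xs) φ≡ψ = cong₂ _+_ (φ≡ψ (here refl)) (sum-map-cong xs (λ y∈ → φ≡ψ (there y∈)))

  sum-map-mono : ∀ {φ ψ : A → ℚ} xs → (∀ {x} → x ∈ˡ xs → φ x ≤ ψ x) →
                 sumℚ (map φ xs) ≤ sumℚ (map ψ xs)
  sum-map-mono [] φ≤ψ = ℚₚ.≤-refl
  sum-map-mono (x ∷ xs) φ≤ψ = ℚₚ.+-mono-≤ (φ≤ψ (here refl)) (sum-map-mono xs (λ y∈ → φ≤ψ (there y∈)))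

  sum-map-zero : ∀ {φ : A → ℚ} xs → (∀ {x} → x ∈ˡ xs → φ x ≡ 0ℚ) → sumℚ (map φ xs) ≡ 0ℚ
  sum-map-zero [] φ≡0 = refl
  sum-map-zero (x ∷ xs) φ≡0 rewrite φ≡0 (here refl) | sum-map-zero xs (λ y∈ → φ≡0 (there y∈)) = refl

  sum-map-nonNeg : ∀ {φ : A → ℚ} xs → (∀ {x} → x ∈ˡ xs → 0ℚ ≤ φ x) → 0ℚ ≤ sumℚ (map φ xs)
  sum-map-nonNeg [] 0≤φ = ℚₚ.≤-refl
  sum-map-nonNeg (x ∷ xs) 0≤φ = ℚₚ.+-mono-≤ (0≤φ (here refl)) (sum-map-nonNeg xs (λ y∈ → 0≤φ (there y∈)))

  term≤sum-map : ∀ {φ : A → ℚ} xs → (∀ {x} → x ∈ˡ xs → 0ℚ ≤ φ x) →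
                 ∀ {y} → y ∈ˡ xs → φ y ≤ sumℚ (map φ xs)
  term≤sum-map {φ} (x ∷ xs) 0≤φ (here refl) = subst (_≤ sumℚ (map φ (x ∷ xs))) (ℚₚ.+-identityʳ (φ x))
    (ℚₚ.+-monoʳ-≤ (φ x) (sum-map-nonNeg xs (λ y∈ → 0≤φ (there y∈))))
  term≤sum-map {φ} (x ∷ xs) 0≤φ {y} (there y∈) = subst (_≤ sumℚ (map φ (x ∷ xs))) (ℚₚ.+-identityˡ (φ y))
    (ℚₚ.+-mono-≤ (0≤φ (here refl)) (term≤sum-map xs (λ z∈ → 0≤φ (there z∈)) y∈))

module _ {A : Set} {P : Pred A 0ℓ} (P? : Decidable P) where

  sum-map-filter : ∀ (φ : A → ℚ) xs →
                   sumℚ (map φ (filter P? xs)) ≡ sumℚ (map (λ x → if does (P? x) then φ x else 0ℚ) xs)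
  sum-map-filter φ [] = refl
  sum-map-filter φ (x ∷ xs) with does (P? x)
  ... | true  = cong (λ s → φ x + s) (sum-map-filter φ xs)
  ... | false = trans (sum-map-filter φ xs) (sym (ℚₚ.+-identityˡ _))

  length-filter≡sum : ∀ xs →
                      + length (filter P? xs) / 1 ≡ sumℚ (map (λ x → if does (P? x) then 1ℚ else 0ℚ) xs)
  length-filter≡sum [] = refl
  length-filter≡sum (x ∷ xs) with does (P? x)
  ... | true  = trans (sym (/-+ (+ 1) (+ length (filter P? xs)) 0)) (cong (λ s → 1ℚ + s) (length-filter≡sum xs))
  ... | false = trans (length-filter≡sum xs) (sym (ℚₚ.+-identityˡ _))

module _ {A : Set} (_≟_ : (x y : A) → Dec (x ≡ y)) where

  sum-map-indicator : ∀ (φ : A → ℚ) {x} xs → AllPairs (λ a b → ¬ a ≡ b) xs → x ∈ˡ xs →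
                      sumℚ (map (λ u → if does (u ≟ x) then φ u else 0ℚ) xs) ≡ φ x
  sum-map-indicator φ (y ∷ xs) (y∉xs ∷ _) (here refl) with y ≟ y
  ... | no y≢y = contradiction refl y≢y
  ... | yes _  = trans (cong (λ s → φ y + s) (sum-map-zero xs others-vanish)) (ℚₚ.+-identityʳ (φ y))
    where
    others-vanish : ∀ {z} → z ∈ˡ xs → (if does (z ≟ y) then φ z else 0ℚ) ≡ 0ℚ
    others-vanish {z} z∈ with z ≟ y
    ... | yes refl = contradiction refl (All.lookup y∉xs z∈)
    ... | no _     = refl
  sum-map-indicator φ {x} (y ∷ xs) (y∉xs ∷ unique) (there x∈) with y ≟ x
  ... | yes refl = contradiction refl (All.lookup y∉xs x∈)
  ... | no _     = trans (ℚₚ.+-identityˡ _) (sum-map-indicator φ xs unique x∈)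

module _ {A : Set} where

  any-∈ : ∀ (p : A → Bool) {xs x} → x ∈ˡ xs → p x ≡ true → any p xs ≡ true
  any-∈ p (here refl) px rewrite px = refl
  any-∈ p {y ∷ xs} (there x∈) px rewrite any-∈ p x∈ px = Boolₚ.∨-zeroʳ (p y)

  any-witness : ∀ (p : A → Bool) xs → any p xs ≡ true → Σ A λ x → x ∈ˡ xs × p x ≡ true
  any-witness p (y ∷ xs) any≡true with p y in py
  ... | true = y , here refl , py
  ... | false with any-witness p xs any≡true
  ...   | x , x∈ , px = x , there x∈ , px

  any-false : ∀ (p : A → Bool) xs → any p xs ≡ false → ∀ {x} → x ∈ˡ xs → p x ≡ false
  any-false p (y ∷ xs) _ (here refl) with p y
  ... | false = refl
  any-false p (y ∷ xs) any≡false (there x∈) with p y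
  ... | false = any-false p xs any≡false x∈

∈⇒0<length : ∀ {A : Set} {x : A} {xs} → x ∈ˡ xs → 0 ℕ.< length xs
∈⇒0<length (here _)  = ℕ.s≤s ℕ.z≤n
∈⇒0<length (there _) = ℕ.s≤s ℕ.z≤n

≤foldr-⊔ : ∀ {A : Set} (φ : A → ℕ) {xs a} → a ∈ˡ xs → φ a ℕ.≤ foldr ℕ._⊔_ 0 (map φ xs)
≤foldr-⊔ φ {x ∷ xs} (here refl) = ℕₚ.m≤m⊔n (φ x) _
≤foldr-⊔ φ {x ∷ xs} (there a∈)  = ℕₚ.≤-trans (≤foldr-⊔ φ a∈) (ℕₚ.m≤n⊔m (φ x) _)

≤foldr-⊔ℚ : ∀ {A : Set} (φ : A → ℚ) {xs a} → a ∈ˡ xs → φ a ≤ foldr ℚ._⊔_ 0ℚ (map φ xs)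
≤foldr-⊔ℚ φ {x ∷ xs} (here refl) = ℚₚ.p≤p⊔q (φ x) _
≤foldr-⊔ℚ φ {x ∷ xs} (there a∈)  = ℚₚ.≤-trans (≤foldr-⊔ℚ φ a∈) (ℚₚ.p≤q⊔p (φ x) _)

lcm≢0 : ∀ {m n} → m ≢ 0 → n ≢ 0 → lcm m n ≢ 0
lcm≢0 {m} {n} m≢0 n≢0 lcm≡0 with ℕₚ.m*n≡0⇒m≡0∨n≡0 m
  (trans (sym (gcd*lcm m n)) (trans (cong (gcd m n ℕ.*_) lcm≡0) (ℕₚ.*-zeroʳ (gcd m n))))
... | inj₁ m≡0 = m≢0 m≡0
... | inj₂ n≡0 = n≢0 n≡0

module _ {A : Set} (φ : A → ℚ) where

  foldr-lcm-↧≢0 : ∀ xs → foldr lcm 1 (map (λ a → ↧ₙ φ a) xs) ≢ 0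
  foldr-lcm-↧≢0 []       = λ ()
  foldr-lcm-↧≢0 (x ∷ xs) = lcm≢0 (λ ()) (foldr-lcm-↧≢0 xs)

  ↧∣foldr-lcm : ∀ {xs a} → a ∈ˡ xs → ↧ₙ φ a ∣ foldr lcm 1 (map (λ a → ↧ₙ φ a) xs)
  ↧∣foldr-lcm {x ∷ xs} (here refl) = m∣lcm[m,n] (↧ₙ φ x) (foldr lcm 1 (map (λ a → ↧ₙ φ a) xs))
  ↧∣foldr-lcm {x ∷ xs} (there a∈)  =
    ∣-trans (↧∣foldr-lcm a∈) (n∣lcm[m,n] (↧ₙ φ x) (foldr lcm 1 (map (λ a → ↧ₙ φ a) xs)))

-- Granularity

Granular : ℚ → ℚ → Set
Granular δ q = q ≤ 0ℚ ⊎ δ ≤ q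

granular-+ : ∀ {δ p q} → 0ℚ ≤ p → 0ℚ ≤ q → Granular δ p → Granular δ q → Granular δ (p + q)
granular-+ _ _ (inj₁ p≤0) (inj₁ q≤0) = inj₁ (ℚₚ.+-mono-≤ p≤0 q≤0)
granular-+ {δ} _ 0≤q (inj₂ δ≤p) _ = inj₂ (subst (_≤ _) (ℚₚ.+-identityʳ δ) (ℚₚ.+-mono-≤ δ≤p 0≤q))
granular-+ {δ} 0≤p _ (inj₁ _) (inj₂ δ≤q) = inj₂ (subst (_≤ _) (ℚₚ.+-identityˡ δ) (ℚₚ.+-mono-≤ 0≤p δ≤q))

sum-map-granular : ∀ {A : Set} {δ} {φ : A → ℚ} xs → (∀ x → 0ℚ ≤ φ x) → (∀ x → Granular δ (φ x)) →
                   Granular δ (sumℚ (map φ xs))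
sum-map-granular [] _ _ = inj₁ ℚₚ.≤-refl
sum-map-granular (x ∷ xs) 0≤φ gran =
  granular-+ (0≤φ x) (sum-map-nonNeg xs (λ {y} _ → 0≤φ y)) (gran x) (sum-map-granular xs 0≤φ gran)

granular-mono : ∀ {δ ε q} → δ ≤ ε → Granular ε q → Granular δ q
granular-mono _   (inj₁ q≤0) = inj₁ q≤0
granular-mono δ≤ε (inj₂ ε≤q) = inj₂ (ℚₚ.≤-trans δ≤ε ε≤q)

granular-pos : ∀ {δ q} → 0ℚ < q → Granular δ q → δ ≤ q
granular-pos 0<q (inj₁ q≤0) = contradiction (ℚₚ.<-≤-trans 0<q q≤0) (ℚₚ.<-irrefl refl)
granular-pos _   (inj₂ δ≤q) = δ≤q

*-01-granular : ∀ {δ q} → q ≡ 0ℚ ⊎ q ≡ 1ℚ → Granular δ (δ * q)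
*-01-granular {δ} (inj₁ q≡0) = inj₁ (ℚₚ.≤-reflexive (trans (cong (δ *_) q≡0) (ℚₚ.*-zeroʳ δ)))
*-01-granular {δ} (inj₂ q≡1) = inj₂ (ℚₚ.≤-reflexive (sym (trans (cong (δ *_) q≡1) (ℚₚ.*-identityʳ δ))))

record OnGrid (l : ℕ) (q : ℚ) : Set where
  constructor onGrid
  field
    scaled  : ℤ
    scaled≡ : q * (+ l / 1) ≡ scaled / 1

onGrid-0ℚ : ∀ l → OnGrid l 0ℚ
onGrid-0ℚ l = onGrid (+ 0) (ℚₚ.*-zeroˡ (+ l / 1))

onGrid-+ : ∀ {l p q} → OnGrid l p → OnGrid l q → OnGrid l (p + q)
onGrid-+ {l} {p} {q} (onGrid i p≡) (onGrid j q≡) = onGrid (i ℤ.+ j)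
  (trans (ℚₚ.*-distribʳ-+ (+ l / 1) p q) (trans (cong₂ _+_ p≡ q≡) (/-+ i j 0)))

onGrid-if : ∀ {l q} b → OnGrid l q → OnGrid l (if b then q else 0ℚ)
onGrid-if true  q-on = q-on
onGrid-if {l} false _ = onGrid-0ℚ l

↧∣⇒onGrid : ∀ {l} q → ↧ₙ q ∣ l → OnGrid l q
↧∣⇒onGrid {l} q@(mkℚ i d _) (divides k l≡k*d) = onGrid (i ℤ.* + k) (begin
  q * (+ l / 1)               ≡⟨ cong (_* (+ l / 1)) (ℚₚ.↥p/↧p≡p q) ⟨
  (i / suc d) * (+ l / 1)     ≡⟨ /-* i (+ l) d 0 ⟩
  (i ℤ.* + l) / (suc d ℕ.* 1) ≡⟨ /-≡ (i ℤ.* + l) (i ℤ.* + k) (d ℕ.* 1) 0 cross ⟩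
  (i ℤ.* + k) / 1             ∎)
  where
  open ≡-Reasoning
  cross : (i ℤ.* + l) ℤ.* + 1 ≡ (i ℤ.* + k) ℤ.* + suc (d ℕ.* 1)
  cross = begin
    (i ℤ.* + l) ℤ.* + 1                ≡⟨ cong (λ z → (i ℤ.* z) ℤ.* + 1) (trans (cong +_ l≡k*d) (ℤₚ.pos-* k (suc d))) ⟩
    (i ℤ.* (+ k ℤ.* + suc d)) ℤ.* + 1  ≡⟨ trans (ℤₚ.*-identityʳ _) (sym (ℤₚ.*-assoc i (+ k) (+ suc d))) ⟩
    (i ℤ.* + k) ℤ.* + suc d            ≡⟨ cong (λ z → (i ℤ.* + k) ℤ.* + suc z) (ℕₚ.*-identityʳ d) ⟨
    (i ℤ.* + k) ℤ.* + suc (d ℕ.* 1)    ∎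

onGrid-gap : ∀ {k p q} → OnGrid (suc k) p → OnGrid (suc k) q → p < q → p + + 1 / suc k ≤ q
onGrid-gap {k} {p} {q} (onGrid i p≡) (onGrid j q≡) p<q = ℚₚ.*-cancelʳ-≤-pos K {{positive 0<K}} (begin
  (p + + 1 / suc k) * K       ≡⟨ ℚₚ.*-distribʳ-+ K p (+ 1 / suc k) ⟩
  p * K + (+ 1 / suc k) * K   ≡⟨ cong₂ _+_ p≡ (trans (ℚₚ.*-comm (+ 1 / suc k) K) (suc/1*1/suc≡1 k)) ⟩
  i / 1 + 1ℚ                  ≡⟨ /-+ i (+ 1) 0 ⟩
  (i ℤ.+ + 1) / 1             ≤⟨ /-≤ (i ℤ.+ + 1) j 0 0 (ℤₚ.*-monoʳ-≤-nonNeg (+ 1) i+1≤j) ⟩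
  j / 1                       ≡⟨ q≡ ⟨
  q * K                       ∎)
  where
  open ℚₚ.≤-Reasoning
  K = + suc k / 1
  0<K : 0ℚ < K
  0<K = ℚₚ.<-≤-trans (ℚₚ.positive⁻¹ 1ℚ) (ℕ/1-mono-≤ {1} {suc k} (ℕ.s≤s ℕ.z≤n))
  i<j : i ℤ.< j
  i<j = subst₂ ℤ._<_ (ℤₚ.*-identityʳ i) (ℤₚ.*-identityʳ j)
          (/-<⁻ i j 0 0 (subst₂ _<_ p≡ q≡ (ℚₚ.*-monoˡ-<-pos K {{positive 0<K}} p<q)))
  i+1≤j : i ℤ.+ + 1 ℤ.≤ j
  i+1≤j = subst (ℤ._≤ j) (ℤₚ.+-comm (+ 1) i) (ℤₚ.i<j⇒suc[i]≤j i<j)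

onGrid-granular : ∀ {k p q} → OnGrid (suc k) p → OnGrid (suc k) q → Granular (+ 1 / suc k) (q - p)
onGrid-granular {k} {p} {q} p-on q-on with q ℚₚ.≤? p
... | yes q≤p = inj₁ (subst (q - p ≤_) (ℚₚ.+-inverseʳ p) (ℚₚ.+-monoˡ-≤ (- p) q≤p))
... | no  q≰p = inj₂ (subst (_≤ q - p) (solve 2 (λ p d → p :+ d :- p := d) refl p (+ 1 / suc k))
                  (ℚₚ.+-monoˡ-≤ (- p) (onGrid-gap p-on q-on (ℚₚ.≰⇒> q≰p))))

onGrid-⊓ : ∀ {l p q} → OnGrid l p → OnGrid l q → OnGrid l (p ⊓ q)
onGrid-⊓ {l} {p} {q} p-on q-on with ℚₚ.⊓-sel p q
... | inj₁ p⊓q≡p = subst (OnGrid l) (sym p⊓q≡p) p-on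
... | inj₂ p⊓q≡q = subst (OnGrid l) (sym p⊓q≡q) q-on

onGrid-sum : ∀ {A : Set} {l} {φ : A → ℚ} xs → (∀ {x} → x ∈ˡ xs → OnGrid l (φ x)) → OnGrid l (sumℚ (map φ xs))
onGrid-sum {l = l} []       _    = onGrid-0ℚ l
onGrid-sum         (x ∷ xs) f-on = onGrid-+ (f-on (here refl)) (onGrid-sum xs (λ y∈ → f-on (there y∈)))

onGrid-if-else : ∀ {l p q} b → OnGrid l p → OnGrid l q → OnGrid l (if b then p else q)
onGrid-if-else true  p-on _    = p-on
onGrid-if-else false _    q-on = q-on

if-≤?≡⊓ : ∀ p q → (if does (p ℚₚ.≤? q) then p else q) ≡ p ⊓ q
if-≤?≡⊓ p q = by-cases (p ℚₚ.≤? q)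
  where
  by-cases : (p≤?q : Dec (p ≤ q)) → (if does p≤?q then p else q) ≡ p ⊓ q
  by-cases (yes p≤q) = sym (ℚₚ.p≤q⇒p⊓q≡p p≤q)
  by-cases (no p≰q)  = sym (ℚₚ.p≥q⇒p⊓q≡q (ℚₚ.<⇒≤ (ℚₚ.≰⇒> p≰q)))

-- Below c, truncation at c is a translation: c ⊓ e′ - a′ = (c - a′) ⊓ (e′ - a′).
⊓-submodular : ∀ c {a a′ e e′} → a ≤ a′ → a ≤ e → a′ ≤ e′ → e′ - a′ ≤ e - a →
               c ⊓ e′ - c ⊓ a′ ≤ c ⊓ e - c ⊓ a
⊓-submodular c {a} {a′} {e} {e′} a≤a′ a≤e a′≤e′ e′-a′≤e-a with c ℚₚ.≤? a′
... | yes c≤a′ = begin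
  c ⊓ e′ - c ⊓ a′  ≡⟨ cong₂ _-_ (ℚₚ.p≤q⇒p⊓q≡p (ℚₚ.≤-trans c≤a′ a′≤e′)) (ℚₚ.p≤q⇒p⊓q≡p c≤a′) ⟩
  c - c            ≡⟨ ℚₚ.+-inverseʳ c ⟩
  0ℚ               ≤⟨ p≤q⇒0≤q-p (ℚₚ.⊓-monoʳ-≤ c a≤e) ⟩
  c ⊓ e - c ⊓ a    ∎
  where open ℚₚ.≤-Reasoning
... | no c≰a′ = begin
  c ⊓ e′ - c ⊓ a′        ≡⟨ cong (λ t → c ⊓ e′ - t) (ℚₚ.p≥q⇒p⊓q≡q a′≤c) ⟩
  c ⊓ e′ - a′            ≡⟨ ℚₚ.mono-≤-distrib-⊓ (ℚₚ.+-monoˡ-≤ (- a′)) c e′ ⟩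
  (c - a′) ⊓ (e′ - a′)   ≤⟨ ℚₚ.⊓-mono-≤ (ℚₚ.+-monoʳ-≤ c (ℚₚ.neg-antimono-≤ a≤a′)) e′-a′≤e-a ⟩
  (c - a) ⊓ (e - a)      ≡⟨ ℚₚ.mono-≤-distrib-⊓ (ℚₚ.+-monoˡ-≤ (- a)) c e ⟨
  c ⊓ e - a              ≡⟨ cong (λ t → c ⊓ e - t) (ℚₚ.p≥q⇒p⊓q≡q (ℚₚ.≤-trans a≤a′ a′≤c)) ⟨
  c ⊓ e - c ⊓ a          ∎
  where
  open ℚₚ.≤-Reasoning
  a′≤c = ℚₚ.<⇒≤ (ℚₚ.≰⇒> c≰a′)

if-mono : ∀ {a b t} → 0ℚ ≤ t → (a ≡ true → b ≡ true) → (if a then t else 0ℚ) ≤ (if b then t else 0ℚ)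
if-mono {false} {false} _ _ = ℚₚ.≤-refl
if-mono {false} {true}  0≤t _ = 0≤t
if-mono {true}  {true}  _ _ = ℚₚ.≤-refl
if-mono {true}  {false} _ a⇒b = contradiction (a⇒b refl) λ ()

if-∨-submodular : ∀ {a b c t} → 0ℚ ≤ t → (a ≡ true → b ≡ true) →
                  (if b ∨ c then t else 0ℚ) - (if b then t else 0ℚ) ≤ (if a ∨ c then t else 0ℚ) - (if a then t else 0ℚ)
if-∨-submodular {true}  {true}  _   _ = ℚₚ.≤-refl
if-∨-submodular {true}  {false} _   a⇒b = contradiction (a⇒b refl) λ ()
if-∨-submodular {false} {false} _   _ = ℚₚ.≤-refl
if-∨-submodular {false} {true} {c} {t} 0≤t _ = subst (_≤ (if c then t else 0ℚ) - 0ℚ) (sym (ℚₚ.+-inverseʳ t))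
  (subst (0ℚ ≤_) (sym (ℚₚ.+-identityʳ _)) (if-mono {false} {c} 0≤t λ ()))

indicator : Bool → ℚ
indicator b = if does (b Bool.≟ true) then 1ℚ else 0ℚ

indicator≤1 : ∀ b → indicator b ≤ 1ℚ
indicator≤1 true  = ℚₚ.≤-refl
indicator≤1 false = ℚₚ.≤ᵇ⇒≤ _

indicator-step : ∀ {a a′} → (a ≡ true → a′ ≡ true) →
                 indicator a′ - indicator a ≡ 0ℚ ⊎ indicator a′ - indicator a ≡ 1ℚ
indicator-step {true}  {true}  _ = inj₁ refl
indicator-step {true}  {false} a⇒a′ = contradiction (a⇒a′ refl) λ ()
indicator-step {false} {true}  _ = inj₂ refl
indicator-step {false} {false} _ = inj₁ refl

indicator-step-nonNeg : ∀ {a a′} → (a ≡ true → a′ ≡ true) → 0ℚ ≤ indicator a′ - indicator a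
indicator-step-nonNeg a⇒a′ with indicator-step a⇒a′
... | inj₁ ≡0 = ℚₚ.≤-reflexive (sym ≡0)
... | inj₂ ≡1 = subst (0ℚ ≤_) (sym ≡1) (ℚₚ.≤ᵇ⇒≤ _)

indicator-mono : ∀ {a a′} → (a ≡ true → a′ ≡ true) → indicator a ≤ indicator a′
indicator-mono a⇒a′ = 0≤q-p⇒p≤q (indicator-step-nonNeg a⇒a′)

-- a, a′ and b, b′ are coverage before and after adding a vertex, to A and to B ⊇ A.
indicator-submodular : ∀ {a a′ b b′} → (a ≡ true → a′ ≡ true) → (b ≡ true → b′ ≡ true) →
                       (a ≡ true → b ≡ true) → (b′ ≡ true → b ≡ false → a′ ≡ true) →
                       indicator b′ - indicator b ≤ indicator a′ - indicator a
indicator-submodular {b = true}  {true}  a⇒a′ _ _ _ = indicator-step-nonNeg a⇒a′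
indicator-submodular {b = true}  {false} _ b⇒b′ _ _ = contradiction (b⇒b′ refl) λ ()
indicator-submodular {b = false} {false} a⇒a′ _ _ _ = indicator-step-nonNeg a⇒a′
indicator-submodular {true}  {b = false} {true} _ _ a⇒b _ = contradiction (a⇒b refl) λ ()
indicator-submodular {false} {false} {false} {true} _ _ _ hit = contradiction (hit refl refl) λ ()
indicator-submodular {false} {true}  {false} {true} _ _ _ _ = ℚₚ.≤-refl

if-swap : ∀ a b (t : ℚ) → (if a then (if b then t else 0ℚ) else 0ℚ) ≡ (if b then (if a then t else 0ℚ) else 0ℚ)
if-swap true  true  t = refl
if-swap true  false t = refl
if-swap false true  t = refl
if-swap false false t = refl

-- Exponential partial sums

expTerm-nonNeg : ∀ {y} n → 0ℚ ≤ y → 0ℚ ≤ expTerm y n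
expTerm-nonNeg zero    _   = ℚₚ.<⇒≤ (ℚₚ.positive⁻¹ 1ℚ)
expTerm-nonNeg (suc n) 0≤y = 0≤p*q (0≤p*q (expTerm-nonNeg n 0≤y) 0≤y) (1/suc-nonNeg n)

expTerm-mono : ∀ {y b} n → 0ℚ ≤ y → y ≤ b → expTerm y n ≤ expTerm b n
expTerm-mono zero    _   _   = ℚₚ.≤-refl
expTerm-mono {y} {b} (suc n) 0≤y y≤b = *-monoʳ-≤-0≤ (1/suc-nonNeg n) (ℚₚ.≤-trans
  (*-monoʳ-≤-0≤ 0≤y (expTerm-mono n 0≤y y≤b))
  (*-monoˡ-≤-0≤ (expTerm-nonNeg n (ℚₚ.≤-trans 0≤y y≤b)) y≤b))

expPartial-nonNeg : ∀ {y} N → 0ℚ ≤ y → 0ℚ ≤ expPartial y N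
expPartial-nonNeg zero    0≤y = expTerm-nonNeg 0 0≤y
expPartial-nonNeg (suc N) 0≤y = ℚₚ.+-mono-≤ (expPartial-nonNeg N 0≤y) (expTerm-nonNeg (suc N) 0≤y)

expPartial-0ℚ : ∀ N → expPartial 0ℚ N ≡ 1ℚ
expPartial-0ℚ zero    = refl
expPartial-0ℚ (suc N)
  rewrite expPartial-0ℚ N | ℚₚ.*-zeroʳ (expTerm 0ℚ N) | ℚₚ.*-zeroˡ (+ 1 / suc N) = refl

-- Truncated form of exp(y) ≥ (1 - a) exp(y + a), for y, a ≥ 0.
module _ (y a : ℚ) (0≤y : 0ℚ ≤ y) (0≤a : 0ℚ ≤ a) where

  private
    b = y + a
    t = expTerm b
    s = expTerm y

    0≤b : 0ℚ ≤ b
    0≤b = ℚₚ.+-mono-≤ 0≤y 0≤a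

    y≤b : y ≤ b
    y≤b = subst (_≤ b) (ℚₚ.+-identityʳ y) (ℚₚ.+-monoʳ-≤ y 0≤a)

  expTerm-increment : ∀ n → t (suc n) - s (suc n) ≤ a * t n
  expTerm-increment zero = ℚₚ.≤-reflexive
    (solve 2 (λ y a → con 1ℚ :* (y :+ a) :* con 1ℚ :- con 1ℚ :* y :* con 1ℚ := a :* con 1ℚ) refl y a)
  expTerm-increment (suc n) = begin
    t (suc n) * b * c - s (suc n) * y * c
      ≡⟨ solve 5 (λ T S y a c → T :* (y :+ a) :* c :- S :* y :* c := c :* ((y :+ a) :* (T :- S) :+ a :* S))
           refl (t (suc n)) (s (suc n)) y a c ⟩
    c * (b * (t (suc n) - s (suc n)) + a * s (suc n))
      ≤⟨ *-monoˡ-≤-0≤ (1/suc-nonNeg (suc n)) (ℚₚ.+-mono-≤ (*-monoˡ-≤-0≤ 0≤b (expTerm-increment n))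
                                                          (*-monoˡ-≤-0≤ 0≤a (expTerm-mono (suc n) 0≤y y≤b))) ⟩
    c * (b * (a * t n) + a * t (suc n))
      ≡⟨ cong (λ z → c * (z + a * t (suc n))) b*a*t≡ ⟩
    c * (a * (t (suc n) * n+1) + a * t (suc n))
      ≡⟨ solve 4 (λ c a T N → c :* (a :* (T :* N) :+ a :* T) := a :* T :* (c :* (N :+ con 1ℚ))) refl c a (t (suc n)) n+1 ⟩
    a * t (suc n) * (c * (n+1 + 1ℚ))
      ≡⟨ cong (λ z → a * t (suc n) * (c * z)) (ℕ/1+1≡suc/1 (suc n)) ⟩
    a * t (suc n) * (c * (+ suc (suc n) / 1))
      ≡⟨ cong (a * t (suc n) *_) (trans (ℚₚ.*-comm c _) (suc/1*1/suc≡1 (suc n))) ⟩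
    a * t (suc n) * 1ℚ
      ≡⟨ ℚₚ.*-identityʳ _ ⟩
    a * t (suc n) ∎
    where
    open ℚₚ.≤-Reasoning
    c = + 1 / suc (suc n)
    n+1 = + suc n / 1
    b*a*t≡ : b * (a * t n) ≡ a * (t (suc n) * n+1)
    b*a*t≡ = begin-equality
      b * (a * t n)
        ≡⟨ trans (cong (λ z → b * (a * t n) * z) (suc/1*1/suc≡1 n)) (ℚₚ.*-identityʳ _) ⟨
      b * (a * t n) * (n+1 * (+ 1 / suc n))
        ≡⟨ solve 5 (λ b a T N c → b :* (a :* T) :* (N :* c) := a :* (T :* b :* c :* N))
             refl b a (t n) n+1 (+ 1 / suc n) ⟩
      a * (t (suc n) * n+1) ∎

  expPartial-increment : ∀ N → expPartial b N - expPartial y N + a * t N ≤ a * expPartial b N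
  expPartial-increment zero = ℚₚ.≤-reflexive (solve 1 (λ a → con 1ℚ :- con 1ℚ :+ a :* con 1ℚ := a :* con 1ℚ) refl a)
  expPartial-increment (suc N) = begin
    (Eb + t (suc N)) - (Ey + s (suc N)) + a * t (suc N)
      ≡⟨ solve 6 (λ Eb Ey T S a P → (Eb :+ T) :- (Ey :+ S) :+ a :* T
                                   := (Eb :- Ey :+ a :* P) :+ (T :- S) :+ a :* T :- a :* P)
           refl Eb Ey (t (suc N)) (s (suc N)) a (t N) ⟩
    (Eb - Ey + a * t N) + (t (suc N) - s (suc N)) + a * t (suc N) - a * t N
      ≤⟨ ℚₚ.+-monoˡ-≤ (- (a * t N)) (ℚₚ.+-monoˡ-≤ (a * t (suc N))
           (ℚₚ.+-mono-≤ (expPartial-increment N) (expTerm-increment N))) ⟩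
    a * Eb + a * t N + a * t (suc N) - a * t N
      ≡⟨ solve 4 (λ a Eb T U → a :* Eb :+ a :* T :+ a :* U :- a :* T := a :* (Eb :+ U)) refl a Eb (t N) (t (suc N)) ⟩
    a * (Eb + t (suc N)) ∎
    where
    open ℚₚ.≤-Reasoning
    Eb = expPartial b N
    Ey = expPartial y N

  expPartial-shift : ∀ N → (1ℚ - a) * expPartial (y + a) N ≤ expPartial y N
  expPartial-shift N = 0≤q-p⇒p≤q (subst (0ℚ ≤_) rearrange (p≤q⇒0≤q-p (ℚₚ.≤-trans
    (subst (_≤ Eb - Ey + a * t N) (ℚₚ.+-identityʳ (Eb - Ey))
      (ℚₚ.+-monoʳ-≤ (Eb - Ey) (0≤p*q 0≤a (expTerm-nonNeg N 0≤b))))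
    (expPartial-increment N))))
    where
    Eb = expPartial b N
    Ey = expPartial y N
    rearrange : a * Eb - (Eb - Ey) ≡ Ey - (1ℚ - a) * Eb
    rearrange = solve 3 (λ a B Y → a :* B :- (B :- Y) := Y :- (con 1ℚ :- a) :* B) refl a Eb Ey

-- (1 - 1/k)^j ≤ exp(-j/k), in truncated form.
^*expPartial≤1 : ∀ r j N → (1ℚ - + 1 / suc r) ^ j * expPartial (+ j / suc r) N ≤ 1ℚ
^*expPartial≤1 r zero N rewrite ℚₚ.0/n≡0 (suc r) {{_}} | expPartial-0ℚ N = ℚₚ.≤-refl
^*expPartial≤1 r (suc j) N = begin
  (q * q ^ j) * expPartial (+ suc j / suc r) N
    ≡⟨ cong (λ z → (q * q ^ j) * expPartial z N) j+1/k≡ ⟩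
  (q * q ^ j) * expPartial (y + a) N
    ≡⟨ solve 3 (λ q Q E → (q :* Q) :* E := Q :* (q :* E)) refl q (q ^ j) (expPartial (y + a) N) ⟩
  q ^ j * (q * expPartial (y + a) N)
    ≤⟨ *-monoˡ-≤-0≤ (^-nonNeg j) (expPartial-shift y a (ℕ/suc-nonNeg j r) (1/suc-nonNeg r) N) ⟩
  q ^ j * expPartial y N
    ≤⟨ ^*expPartial≤1 r j N ⟩
  1ℚ ∎
  where
  open ℚₚ.≤-Reasoning
  a = + 1 / suc r
  q = 1ℚ - a
  y = + j / suc r
  ^-nonNeg : ∀ i → 0ℚ ≤ q ^ i
  ^-nonNeg zero    = ℚₚ.<⇒≤ (ℚₚ.positive⁻¹ 1ℚ)
  ^-nonNeg (suc i) = 0≤p*q (p≤q⇒0≤q-p (1/suc≤1 r)) (^-nonNeg i)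
  j+1/k≡ : + suc j / suc r ≡ y + a
  j+1/k≡ = sym (trans (/-+ (+ j) (+ 1) r) (cong (λ z → + z / suc r) (ℕₚ.+-comm j 1)))

fromList : ∀ {n} → List (Fin n) → Subset n
fromList = foldr (λ x p → ⁅ x ⁆ ∪ p) ⊥

elements : ∀ {n} → Subset n → List (Fin n)
elements []            = []
elements (inside ∷ p)  = zero ∷ map suc (elements p)
elements (outside ∷ p) = map suc (elements p)

fromList-map-suc : ∀ {n} (xs : List (Fin n)) → fromList (map suc xs) ≡ outside ∷ fromList xs
fromList-map-suc []       = refl
fromList-map-suc (x ∷ xs) rewrite fromList-map-suc xs = refl

fromList-elements : ∀ {n} (p : Subset n) → fromList (elements p) ≡ p
fromList-elements [] = refl
fromList-elements (inside ∷ p)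
  rewrite fromList-map-suc (elements p) | fromList-elements p | Subsetₚ.∪-identityˡ p = refl
fromList-elements (outside ∷ p) rewrite fromList-map-suc (elements p) | fromList-elements p = refl

length-elements : ∀ {n} (p : Subset n) → length (elements p) ≡ ∣ p ∣
length-elements []            = refl
length-elements (inside ∷ p)  = cong suc (trans (Listₚ.length-map suc (elements p)) (length-elements p))
length-elements (outside ∷ p) = trans (Listₚ.length-map suc (elements p)) (length-elements p)

∣p∪⁅x⁆∣≡1+∣p∣ : ∀ {n} {p : Subset n} {x} → x ∉ p → ∣ p ∪ ⁅ x ⁆ ∣ ≡ suc ∣ p ∣
∣p∪⁅x⁆∣≡1+∣p∣ {p = outside ∷ p} {zero}  _   rewrite Subsetₚ.∪-identityʳ p = refl
∣p∪⁅x⁆∣≡1+∣p∣ {p = inside  ∷ p} {zero}  x∉p = contradiction here x∉p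
∣p∪⁅x⁆∣≡1+∣p∣ {p = inside  ∷ p} {suc x} x∉p = cong suc (∣p∪⁅x⁆∣≡1+∣p∣ (λ x∈p → x∉p (there x∈p)))
∣p∪⁅x⁆∣≡1+∣p∣ {p = outside ∷ p} {suc x} x∉p = ∣p∪⁅x⁆∣≡1+∣p∣ (λ x∈p → x∉p (there x∈p))

x∈p⇒p∪⁅x⁆⊆p : ∀ {n} {p : Subset n} {x} → x ∈ p → p ∪ ⁅ x ⁆ ⊆ p
x∈p⇒p∪⁅x⁆⊆p {p = p} {x} x∈p y∈ with Subsetₚ.x∈p∪q⁻ p ⁅ x ⁆ y∈
... | inj₁ y∈p   = y∈p
... | inj₂ y∈⁅x⁆ = subst (_∈ p) (sym (Subsetₚ.x∈⁅y⁆⇒x≡y x y∈⁅x⁆)) x∈p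

p⊆p∪⁅x⁆ : ∀ {n} (p : Subset n) x → p ⊆ p ∪ ⁅ x ⁆
p⊆p∪⁅x⁆ p x = Subsetₚ.p⊆p∪q {p = p} ⁅ x ⁆

⊆⇒lookup : ∀ {n} {p q : Subset n} → p ⊆ q → ∀ {i} → lookup p i ≡ true → lookup q i ≡ true
⊆⇒lookup {p = p} p⊆q {i} eq = Vecₚ.[]=⇒lookup (p⊆q (Vecₚ.lookup⇒[]= i p eq))

lookup-∪ : ∀ {n} (p q : Subset n) i → lookup (p ∪ q) i ≡ lookup p i ∨ lookup q i
lookup-∪ p q i = Vecₚ.lookup-zipWith _∨_ i p q

∉⇒lookup≡false : ∀ {n} {p : Subset n} {i} → i ∉ p → lookup p i ≡ false
∉⇒lookup≡false {p = p} {i} i∉p with lookup p i in eq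
... | true  = contradiction (Vecₚ.lookup⇒[]= i p eq) i∉p
... | false = refl

∉∪⁅⁆ : ∀ {n} {p : Subset n} {x i} → i ∉ p → i ≢ x → i ∉ p ∪ ⁅ x ⁆
∉∪⁅⁆ {p = p} {x} i∉p i≢x i∈ with Subsetₚ.x∈p∪q⁻ p ⁅ x ⁆ i∈
... | inj₁ i∈p   = i∉p i∈p
... | inj₂ i∈⁅x⁆ = i≢x (Subsetₚ.x∈⁅y⁆⇒x≡y x i∈⁅x⁆)

lookup-⁅⁆ : ∀ {n} (x i : Fin n) → lookup ⁅ x ⁆ i ≡ does (i Fin.≟ x)
lookup-⁅⁆ x i with i Fin.≟ x
... | yes refl = Vecₚ.[]=⇒lookup (Subsetₚ.x∈⁅x⁆ x)
... | no  i≢x  = ∉⇒lookup≡false (Subsetₚ.x≢y⇒x∉⁅y⁆ i≢x)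

data Position {n} (A : Subset n) (x v : Fin n) : Set where
  old       : v ∈ A → Position A x v
  new       : v ∉ A → v ≡ x → Position A x v
  untouched : v ∉ A → v ≢ x → Position A x v

position : ∀ {n} (A : Subset n) x v → Position A x v
position A x v with v Subsetₚ.∈? A | v Fin.≟ x
... | yes v∈A | _       = old v∈A
... | no  v∉A | yes v≡x = new v∉A v≡x
... | no  v∉A | no  v≢x = untouched v∉A v≢x

-- The greedy analysis

module GreedyAnalysis {n : ℕ} (G : WGraph n) {δ X M : ℚ}
  (0<δ : 0ℚ < δ) (1≤X : 1ℚ ≤ X)
  (g-mono : ∀ {A B} → A ⊆ B → g G A ≤ g G B)
  (gain-antitone : ∀ {A B} x → A ⊆ B → gain G B x ≤ gain G A x)
  (gain-granular : ∀ A x → 0ℚ < gain G A x → δ ≤ gain G A x)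
  (gain-⊥≤ : ∀ x → gain G ⊥ x ≤ X * δ)
  (g≤M : ∀ A → g G A ≤ M)
  (feasible⇒M≤g : ∀ T → IsWPPITDS G T → M ≤ g G T)
  where

  g-∪⁅⁆ : ∀ A x → g G (A ∪ ⁅ x ⁆) ≡ g G A + gain G A x
  g-∪⁅⁆ A x = solve 2 (λ u v → u := v :+ (u :- v)) refl (g G (A ∪ ⁅ x ⁆)) (g G A)

  module _ (A : Subset n) {θ : ℚ} (gain≤θ : ∀ y → gain G A y ≤ θ) where

    g-∪-fromList≤ : ∀ {B} → A ⊆ B → ∀ ys → g G (B ∪ fromList ys) ≤ g G B + (+ length ys / 1) * θ
    g-∪-fromList≤ {B} _ [] = ℚₚ.≤-reflexive (trans (cong (g G) (Subsetₚ.∪-identityʳ B))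
      (sym (trans (cong (λ z → g G B + z) (ℚₚ.*-zeroˡ θ)) (ℚₚ.+-identityʳ (g G B)))))
    g-∪-fromList≤ {B} A⊆B (y ∷ ys) = begin
      g G (B ∪ (⁅ y ⁆ ∪ fromList ys))  ≡⟨ cong (g G) (Subsetₚ.∪-assoc B ⁅ y ⁆ (fromList ys)) ⟨
      g G ((B ∪ ⁅ y ⁆) ∪ fromList ys)  ≤⟨ g-∪-fromList≤ {B ∪ ⁅ y ⁆} (λ x∈ → Subsetₚ.p⊆p∪q {p = B} ⁅ y ⁆ (A⊆B x∈)) ys ⟩
      g G (B ∪ ⁅ y ⁆) + ℓ * θ          ≡⟨ cong (_+ ℓ * θ) (g-∪⁅⁆ B y) ⟩
      g G B + gain G B y + ℓ * θ       ≤⟨ ℚₚ.+-monoˡ-≤ (ℓ * θ) (ℚₚ.+-monoʳ-≤ (g G B)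
                                            (ℚₚ.≤-trans (gain-antitone y A⊆B) (gain≤θ y))) ⟩
      g G B + θ + ℓ * θ                ≡⟨ solve 3 (λ a t l → a :+ t :+ l :* t := a :+ (l :+ con 1ℚ) :* t)
                                            refl (g G B) θ ℓ ⟩
      g G B + (ℓ + 1ℚ) * θ             ≡⟨ cong (λ z → g G B + z * θ) (ℕ/1+1≡suc/1 (length ys)) ⟩
      g G B + (+ suc (length ys) / 1) * θ ∎
      where
      open ℚₚ.≤-Reasoning
      ℓ = + length ys / 1

    g-∪≤ : ∀ T → g G (A ∪ T) ≤ g G A + (+ ∣ T ∣ / 1) * θ
    g-∪≤ T = subst₂ _≤_ (cong (λ p → g G (A ∪ p)) (fromList-elements T))
                        (cong (λ k → g G A + (+ k / 1) * θ) (length-elements T))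
                        (g-∪-fromList≤ (λ x∈ → x∈) (elements T))

  ∈⇒gain≤0 : ∀ {S y} → y ∈ S → gain G S y ≤ 0ℚ
  ∈⇒gain≤0 {S} {y} y∈S = begin
    g G (S ∪ ⁅ y ⁆) - g G S  ≤⟨ ℚₚ.+-monoˡ-≤ (- g G S) (g-mono (x∈p⇒p∪⁅x⁆⊆p y∈S)) ⟩
    g G S - g G S            ≡⟨ ℚₚ.+-inverseʳ (g G S) ⟩
    0ℚ                       ∎
    where open ℚₚ.≤-Reasoning

  max-gain-everywhere : ∀ S x → (∀ y → y ∉ S → gain G S y ≤ gain G S x) → 0ℚ < gain G S x →
                        ∀ y → gain G S y ≤ gain G S x
  max-gain-everywhere S x max 0<gain y = by-cases (y Subsetₚ.∈? S)
    where
    by-cases : Dec (y ∈ S) → gain G S y ≤ gain G S x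
    by-cases (no  y∉S) = max y y∉S
    by-cases (yes y∈S) = ℚₚ.≤-trans (∈⇒gain≤0 y∈S) (ℚₚ.<⇒≤ 0<gain)

  record GreedyPrefix (S : Subset n) (d : ℕ) : Set where
    field
      state  : Subset n
      reach  : GreedyReach G state
      size   : ∣ state ∣ ℕ.+ d ≡ ∣ S ∣
      growth : g G state + (+ d / 1) * δ ≤ g G S

  greedy-prefix : ∀ {S} → GreedyReach G S → ∀ d → d ℕ.≤ ∣ S ∣ → GreedyPrefix S d
  greedy-prefix {S} reach zero _ = record
    { state = S ; reach = reach ; size = ℕₚ.+-identityʳ ∣ S ∣
    ; growth = ℚₚ.≤-reflexive (trans (cong (λ z → g G S + z) (ℚₚ.*-zeroˡ δ)) (ℚₚ.+-identityʳ (g G S))) }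
  greedy-prefix start (suc d) d<∣⊥∣ = contradiction (subst (suc d ℕ.≤_) (Subsetₚ.∣⊥∣≡0 n) d<∣⊥∣) λ ()
  greedy-prefix (step {S} x S-reach x∉S 0<gain _) (suc d) d<∣S∪x∣ =
    extend (greedy-prefix S-reach d (ℕ.s≤s⁻¹ (subst (suc d ℕ.≤_) ∣S∪x∣≡ d<∣S∪x∣)))
    where
    ∣S∪x∣≡ = ∣p∪⁅x⁆∣≡1+∣p∣ x∉S
    extend : GreedyPrefix S d → GreedyPrefix (S ∪ ⁅ x ⁆) (suc d)
    extend T = record
      { state = state ; reach = reach
      ; size = trans (ℕₚ.+-suc ∣ state ∣ d) (trans (cong suc size) (sym ∣S∪x∣≡))
      ; growth = begin
          g G state + (+ suc d / 1) * δ     ≡⟨ cong (λ z → g G state + z * δ) (ℕ/1+1≡suc/1 d) ⟨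
          g G state + (+ d / 1 + 1ℚ) * δ    ≡⟨ solve 3 (λ u m e → u :+ (m :+ con 1ℚ) :* e := (u :+ m :* e) :+ e)
                                                 refl (g G state) (+ d / 1) δ ⟩
          (g G state + (+ d / 1) * δ) + δ   ≤⟨ ℚₚ.+-mono-≤ growth (gain-granular S x 0<gain) ⟩
          g G S + gain G S x                ≡⟨ g-∪⁅⁆ S x ⟨
          g G (S ∪ ⁅ x ⁆)                   ∎ }
      where
      open GreedyPrefix T
      open ℚₚ.≤-Reasoning

  module _ (S* : Subset n) (r : ℕ) (∣S*∣≡ : ∣ S* ∣ ≡ suc r) (S*-feasible : IsWPPITDS G S*) where

    private
      k = + suc r / 1
      a = + 1 / suc r
      q = 1ℚ - a

    deficit≤ : ∀ S {θ} → (∀ y → gain G S y ≤ θ) → M - g G S ≤ k * θ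
    deficit≤ S {θ} gain≤θ = begin
      M - g G S                                ≤⟨ ℚₚ.+-monoˡ-≤ (- g G S) (ℚₚ.≤-trans (feasible⇒M≤g S* S*-feasible)
                                                    (g-mono (Subsetₚ.q⊆p∪q S S*))) ⟩
      g G (S ∪ S*) - g G S                     ≤⟨ ℚₚ.+-monoˡ-≤ (- g G S) (g-∪≤ S gain≤θ S*) ⟩
      g G S + (+ ∣ S* ∣ / 1) * θ - g G S       ≡⟨ solve 2 (λ u v → u :+ v :- u := v) refl (g G S) ((+ ∣ S* ∣ / 1) * θ) ⟩
      (+ ∣ S* ∣ / 1) * θ                       ≡⟨ cong (λ i → (+ i / 1) * θ) ∣S*∣≡ ⟩
      k * θ                                    ∎
      where open ℚₚ.≤-Reasoning

    -- Each greedy step closes at least the fraction 1/|S*| of the remaining deficit.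
    greedy-deficit : ∀ {S} → GreedyReach G S → M - g G S ≤ k * (X * δ) * q ^ ∣ S ∣
    greedy-deficit start = subst (λ i → M - g G ⊥ ≤ k * (X * δ) * q ^ i) (sym (Subsetₚ.∣⊥∣≡0 n))
      (subst (M - g G ⊥ ≤_) (sym (ℚₚ.*-identityʳ (k * (X * δ)))) (deficit≤ ⊥ gain-⊥≤))
    greedy-deficit (step {S} x S-reach x∉S 0<gain max) = begin
      M - g G (S ∪ ⁅ x ⁆)               ≡⟨ cong (λ z → M - z) (g-∪⁅⁆ S x) ⟩
      M - (g G S + θ)                   ≤⟨ ℚₚ.+-monoʳ-≤ M (ℚₚ.neg-antimono-≤ (ℚₚ.+-monoʳ-≤ (g G S) a[M-g]≤θ)) ⟩
      M - (g G S + a * (M - g G S))     ≡⟨ solve 3 (λ M u a → M :- (u :+ a :* (M :- u)) := (con 1ℚ :- a) :* (M :- u))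
                                             refl M (g G S) a ⟩
      q * (M - g G S)                   ≤⟨ *-monoˡ-≤-0≤ (p≤q⇒0≤q-p (1/suc≤1 r)) (greedy-deficit S-reach) ⟩
      q * (k * (X * δ) * q ^ ∣ S ∣)     ≡⟨ solve 3 (λ q K Q → q :* (K :* Q) := K :* (q :* Q))
                                             refl q (k * (X * δ)) (q ^ ∣ S ∣) ⟩
      k * (X * δ) * q ^ suc ∣ S ∣       ≡⟨ cong (λ i → k * (X * δ) * q ^ i) (∣p∪⁅x⁆∣≡1+∣p∣ x∉S) ⟨
      k * (X * δ) * q ^ ∣ S ∪ ⁅ x ⁆ ∣   ∎
      where
      open ℚₚ.≤-Reasoning
      θ = gain G S x
      a[M-g]≤θ : a * (M - g G S) ≤ θ
      a[M-g]≤θ = begin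
        a * (M - g G S)  ≤⟨ *-monoˡ-≤-0≤ (ℚₚ.<⇒≤ (1/suc-pos r)) (deficit≤ S (max-gain-everywhere S x max 0<gain)) ⟩
        a * (k * θ)      ≡⟨ ℚₚ.*-assoc a k θ ⟨
        a * k * θ        ≡⟨ cong (_* θ) (trans (ℚₚ.*-comm a k) (suc/1*1/suc≡1 r)) ⟩
        1ℚ * θ           ≡⟨ ℚₚ.*-identityˡ θ ⟩
        θ                ∎

    greedy-bound : ∀ {S} → GreedyReach G S → ∀ N → expPartial (+ (∣ S ∣ ∸ suc r) / suc r) N ≤ X
    greedy-bound {S} S-reach N = by-cases (suc r ℕₚ.≤? ∣ S ∣)
      where
      by-cases : Dec (suc r ℕ.≤ ∣ S ∣) → expPartial (+ (∣ S ∣ ∸ suc r) / suc r) N ≤ X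
      by-cases (no ∣S∣<k) = subst (_≤ X) (sym E≡1) 1≤X
        where
        E≡1 : expPartial (+ (∣ S ∣ ∸ suc r) / suc r) N ≡ 1ℚ
        E≡1 = trans (cong (λ i → expPartial (+ i / suc r) N) (ℕₚ.m≤n⇒m∸n≡0 (ℕₚ.<⇒≤ (ℕₚ.≰⇒> ∣S∣<k))))
                    (trans (cong (λ z → expPartial z N) (ℚₚ.0/n≡0 (suc r))) (expPartial-0ℚ N))
      by-cases (yes k≤∣S∣) = begin
        E               ≡⟨ ℚₚ.*-identityˡ E ⟨
        1ℚ * E          ≤⟨ *-monoʳ-≤-0≤ (expPartial-nonNeg N (ℕ/suc-nonNeg j r)) 1≤X*q^j ⟩
        X * q ^ j * E   ≡⟨ ℚₚ.*-assoc X (q ^ j) E ⟩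
        X * (q ^ j * E) ≤⟨ *-monoˡ-≤-0≤ 0≤X (^*expPartial≤1 r j N) ⟩
        X * 1ℚ          ≡⟨ ℚₚ.*-identityʳ X ⟩
        X               ∎
        where
        open ℚₚ.≤-Reasoning
        j = ∣ S ∣ ∸ suc r
        E = expPartial (+ j / suc r) N
        0≤X = ℚₚ.≤-trans (ℚₚ.<⇒≤ (ℚₚ.positive⁻¹ 1ℚ)) 1≤X
        T = greedy-prefix S-reach (suc r) k≤∣S∣
        open GreedyPrefix T
        ∣T∣≡j : ∣ state ∣ ≡ j
        ∣T∣≡j = trans (sym (ℕₚ.m+n∸n≡m ∣ state ∣ (suc r))) (cong (_∸ suc r) size)
        -- The last |S*| greedy steps gain at least |S*|·δ, but at most the remaining deficit.
        kδ≤kXδq^j : k * δ ≤ k * (δ * (X * q ^ j))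
        kδ≤kXδq^j = begin
          k * δ                              ≡⟨ solve 2 (λ u v → v := (u :+ v) :- u) refl (g G state) (k * δ) ⟩
          (g G state + k * δ) - g G state    ≤⟨ ℚₚ.+-monoˡ-≤ (- g G state) (ℚₚ.≤-trans growth (g≤M S)) ⟩
          M - g G state                      ≤⟨ greedy-deficit reach ⟩
          k * (X * δ) * q ^ ∣ state ∣        ≡⟨ cong (λ i → k * (X * δ) * q ^ i) ∣T∣≡j ⟩
          k * (X * δ) * q ^ j                ≡⟨ solve 4 (λ k X δ Q → k :* (X :* δ) :* Q := k :* (δ :* (X :* Q)))
                                                  refl k X δ (q ^ j) ⟩
          k * (δ * (X * q ^ j))              ∎
        0<k : 0ℚ < k
        0<k = ℚₚ.<-≤-trans (ℚₚ.positive⁻¹ 1ℚ) (ℕ/1-mono-≤ {1} {suc r} (ℕ.s≤s ℕ.z≤n))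
        1≤X*q^j : 1ℚ ≤ X * q ^ j
        1≤X*q^j = *-cancelˡ-≤-0< 0<δ (subst (_≤ δ * (X * q ^ j)) (sym (ℚₚ.*-identityʳ δ))
                    (*-cancelˡ-≤-0< 0<k kδ≤kXδq^j))

-- The potential of a weighted graph

module _ {n : ℕ} (G : WGraph n) where
  open WGraph G

  nbr⇒adj : ∀ {v u} → u ∈ˡ nbrs G v → adj v u ≡ true
  nbr⇒adj {v} u∈ = proj₂ (∈-filter⁻ (λ u → adj v u Bool.≟ true) {xs = allFin n} u∈)

  adj⇒nbr : ∀ {v u} → adj v u ≡ true → u ∈ˡ nbrs G v
  adj⇒nbr {v} {u} vu = ∈-filter⁺ (λ u → adj v u Bool.≟ true) (∈-allFin u) vu

  nbr⇒0<w : ∀ {v u} → u ∈ˡ nbrs G v → 0ℚ < w v u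
  nbr⇒0<w {v} {u} u∈ = w-pos v u (nbr⇒adj u∈)

  edge : Subset n → Fin n → Fin n → ℚ
  edge A v u = if lookup A u then w v u else 0ℚ

  edge-nonNeg : ∀ A {v u} → u ∈ˡ nbrs G v → 0ℚ ≤ edge A v u
  edge-nonNeg A {u = u} u∈ = if-mono {false} {lookup A u} (ℚₚ.<⇒≤ (nbr⇒0<w u∈)) λ ()

  edge-mono : ∀ {A B} → A ⊆ B → ∀ {v u} → u ∈ˡ nbrs G v → edge A v u ≤ edge B v u
  edge-mono A⊆B u∈ = if-mono (ℚₚ.<⇒≤ (nbr⇒0<w u∈)) (⊆⇒lookup A⊆B)

  edge-submodular : ∀ {A B} → A ⊆ B → ∀ x {v u} → u ∈ˡ nbrs G v →
                    edge (B ∪ ⁅ x ⁆) v u - edge B v u ≤ edge (A ∪ ⁅ x ⁆) v u - edge A v u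
  edge-submodular {A} {B} A⊆B x {v} {u} u∈ =
    subst₂ (λ b a → (if b then w v u else 0ℚ) - edge B v u ≤ (if a then w v u else 0ℚ) - edge A v u)
      (sym (lookup-∪ B ⁅ x ⁆ u)) (sym (lookup-∪ A ⁅ x ⁆ u))
      (if-∨-submodular (ℚₚ.<⇒≤ (nbr⇒0<w u∈)) (⊆⇒lookup A⊆B))

  WA-nonNeg : ∀ A v → 0ℚ ≤ WA G A v
  WA-nonNeg A v = sum-map-nonNeg (nbrs G v) (edge-nonNeg A)

  WA-mono : ∀ {A B} → A ⊆ B → ∀ v → WA G A v ≤ WA G B v
  WA-mono A⊆B v = sum-map-mono (nbrs G v) (edge-mono A⊆B)

  WA-submodular : ∀ {A B} → A ⊆ B → ∀ x v → WA G (B ∪ ⁅ x ⁆) v - WA G B v ≤ WA G (A ∪ ⁅ x ⁆) v - WA G A v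
  WA-submodular {A} {B} A⊆B x v = subst₂ _≤_
    (sum-map-- (edge (B ∪ ⁅ x ⁆) v) (edge B v) (nbrs G v)) (sum-map-- (edge (A ∪ ⁅ x ⁆) v) (edge A v) (nbrs G v))
    (sum-map-mono (nbrs G v) (edge-submodular A⊆B x))

  W/2 : Fin n → ℚ
  W/2 v = ½ * Wv G v

  Wv-nonNeg : ∀ v → 0ℚ ≤ Wv G v
  Wv-nonNeg v = sum-map-nonNeg (nbrs G v) (λ u∈ → ℚₚ.<⇒≤ (nbr⇒0<w u∈))

  W/2-nonNeg : ∀ v → 0ℚ ≤ W/2 v
  W/2-nonNeg v = 0≤p*q (ℚₚ.<⇒≤ (ℚₚ.positive⁻¹ ½)) (Wv-nonNeg v)

  influence : Subset n → Fin n → ℚ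
  influence A v = if lookup A v then W/2 v else W/2 v ⊓ WA G A v

  hv≡influence : ∀ A v → hv G A v ≡ influence A v
  hv≡influence A v with lookup A v
  ... | true  = refl
  ... | false = if-≤?≡⊓ (W/2 v) (WA G A v)

  influence-∈ : ∀ {A v} → v ∈ A → influence A v ≡ W/2 v
  influence-∈ v∈A rewrite Vecₚ.[]=⇒lookup v∈A = refl

  influence-∉ : ∀ {A v} → v ∉ A → influence A v ≡ W/2 v ⊓ WA G A v
  influence-∉ v∉A rewrite ∉⇒lookup≡false v∉A = refl

  influence≤W/2 : ∀ A v → influence A v ≤ W/2 v
  influence≤W/2 A v with lookup A v
  ... | true  = ℚₚ.≤-refl
  ... | false = ℚₚ.p⊓q≤p (W/2 v) (WA G A v)

  influence-mono : ∀ {A B} → A ⊆ B → ∀ v → influence A v ≤ influence B v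
  influence-mono {A} {B} A⊆B v with v Subsetₚ.∈? B
  ... | yes v∈B = subst (influence A v ≤_) (sym (influence-∈ v∈B)) (influence≤W/2 A v)
  ... | no  v∉B = subst₂ _≤_ (sym (influence-∉ (λ v∈A → v∉B (A⊆B v∈A)))) (sym (influence-∉ v∉B))
                    (ℚₚ.⊓-monoʳ-≤ (W/2 v) (WA-mono A⊆B v))

  influence-gain : Subset n → Fin n → Fin n → ℚ
  influence-gain A x v = influence (A ∪ ⁅ x ⁆) v - influence A v

  influence-gain-nonNeg : ∀ A x v → 0ℚ ≤ influence-gain A x v
  influence-gain-nonNeg A x v = p≤q⇒0≤q-p (influence-mono (p⊆p∪⁅x⁆ A x) v)

  influence-gain-old : ∀ {A x v} → v ∈ A → influence-gain A x v ≡ 0ℚ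
  influence-gain-old {A} {x} {v} v∈A =
    trans (cong₂ _-_ (influence-∈ (Subsetₚ.p⊆p∪q ⁅ x ⁆ v∈A)) (influence-∈ v∈A)) (ℚₚ.+-inverseʳ (W/2 v))

  influence-gain-new : ∀ {A v} → v ∉ A → influence-gain A v v ≡ W/2 v - W/2 v ⊓ WA G A v
  influence-gain-new {A} {v} v∉A =
    cong₂ _-_ (influence-∈ (Subsetₚ.q⊆p∪q A ⁅ v ⁆ (Subsetₚ.x∈⁅x⁆ v))) (influence-∉ v∉A)

  influence-gain-untouched : ∀ {A x v} → v ∉ A → v ≢ x →
                             influence-gain A x v ≡ W/2 v ⊓ WA G (A ∪ ⁅ x ⁆) v - W/2 v ⊓ WA G A v
  influence-gain-untouched v∉A v≢x = cong₂ _-_ (influence-∉ (∉∪⁅⁆ v∉A v≢x)) (influence-∉ v∉A)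

  influence-gain-antitone : ∀ {A B} → A ⊆ B → ∀ x v → influence-gain B x v ≤ influence-gain A x v
  influence-gain-antitone {A} {B} A⊆B x v with position B x v
  ... | old v∈B = subst (_≤ influence-gain A x v) (sym (influence-gain-old v∈B)) (influence-gain-nonNeg A x v)
  ... | new v∉B refl = subst₂ _≤_ (sym (influence-gain-new v∉B)) (sym (influence-gain-new (v∉B ∘ A⊆B)))
          (ℚₚ.+-monoʳ-≤ (W/2 v) (ℚₚ.neg-antimono-≤ (ℚₚ.⊓-monoʳ-≤ (W/2 v) (WA-mono A⊆B v))))
  ... | untouched v∉B v≢x = subst₂ _≤_ (sym (influence-gain-untouched v∉B v≢x))
          (sym (influence-gain-untouched (v∉B ∘ A⊆B) v≢x))
          (⊓-submodular (W/2 v) (WA-mono A⊆B v) (WA-mono (p⊆p∪⁅x⁆ A x) v)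
             (WA-mono (p⊆p∪⁅x⁆ B x) v) (WA-submodular A⊆B x v))

  covered : Subset n → Fin n → Bool
  covered A v = any (lookup A) (nbrs G v)

  ∈⇒covered : ∀ {A v u} → u ∈ˡ nbrs G v → u ∈ A → covered A v ≡ true
  ∈⇒covered {A} u∈ u∈A = any-∈ (lookup A) u∈ (Vecₚ.[]=⇒lookup u∈A)

  covered⇒∈ : ∀ {A v} → covered A v ≡ true → Σ (Fin n) λ u → u ∈ˡ nbrs G v × u ∈ A
  covered⇒∈ {A} {v} cov with any-witness (lookup A) (nbrs G v) cov
  ... | u , u∈ , Au = u , u∈ , Vecₚ.lookup⇒[]= u A Au

  covered-mono : ∀ {A B} → A ⊆ B → ∀ {v} → covered A v ≡ true → covered B v ≡ true
  covered-mono A⊆B cov with covered⇒∈ cov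
  ... | u , u∈ , u∈A = ∈⇒covered u∈ (A⊆B u∈A)

  newly-covered⇒adj : ∀ {A x v} → covered (A ∪ ⁅ x ⁆) v ≡ true → covered A v ≡ false → adj v x ≡ true
  newly-covered⇒adj {A} {x} {v} cov uncov with covered⇒∈ cov
  ... | u , u∈ , u∈A∪x with Subsetₚ.x∈p∪q⁻ A ⁅ x ⁆ u∈A∪x
  ...   | inj₁ u∈A   = contradiction (trans (sym (∈⇒covered u∈ u∈A)) uncov) λ ()
  ...   | inj₂ u∈⁅x⁆ = subst (λ u → adj v u ≡ true) (Subsetₚ.x∈⁅y⁆⇒x≡y x u∈⁅x⁆) (nbr⇒adj u∈)

  adj⇒covered : ∀ {A x v} → adj v x ≡ true → covered (A ∪ ⁅ x ⁆) v ≡ true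
  adj⇒covered {A} {x} vx = ∈⇒covered (adj⇒nbr vx) (Subsetₚ.q⊆p∪q A ⁅ x ⁆ (Subsetₚ.x∈⁅x⁆ x))

  uncovered⇒WA≡0 : ∀ {A v} → covered A v ≡ false → WA G A v ≡ 0ℚ
  uncovered⇒WA≡0 {A} {v} uncov = sum-map-zero (nbrs G v)
    (λ {u} u∈ → cong (λ b → if b then w v u else 0ℚ) (any-false (lookup A) (nbrs G v) uncov u∈))

  coverage-gain : Subset n → Fin n → Fin n → ℚ
  coverage-gain A x v = indicator (covered (A ∪ ⁅ x ⁆) v) - indicator (covered A v)

  coverage-gain-01 : ∀ A x v → coverage-gain A x v ≡ 0ℚ ⊎ coverage-gain A x v ≡ 1ℚ
  coverage-gain-01 A x v = indicator-step (covered-mono (p⊆p∪⁅x⁆ A x))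

  coverage-gain-nonNeg : ∀ A x v → 0ℚ ≤ coverage-gain A x v
  coverage-gain-nonNeg A x v = indicator-step-nonNeg (covered-mono (p⊆p∪⁅x⁆ A x))

  coverage-gain-antitone : ∀ {A B} → A ⊆ B → ∀ x v → coverage-gain B x v ≤ coverage-gain A x v
  coverage-gain-antitone {A} {B} A⊆B x v = indicator-submodular
    (covered-mono (p⊆p∪⁅x⁆ A x)) (covered-mono (p⊆p∪⁅x⁆ B x)) (covered-mono A⊆B)
    (λ cov uncov → adj⇒covered {A} (newly-covered⇒adj {B} cov uncov))

  δ : ℚ
  δ = recipℕ G (L G)

  recipℕ-nonNeg : ∀ m → 0ℚ ≤ recipℕ G m
  recipℕ-nonNeg zero    = ℚₚ.≤-refl
  recipℕ-nonNeg (suc k) = ℚₚ.<⇒≤ (1/suc-pos k)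

  0≤δ : 0ℚ ≤ δ
  0≤δ = recipℕ-nonNeg (L G)

  potential : Subset n → Fin n → ℚ
  potential A v = influence A v + δ * indicator (covered A v)

  g≡sum-potential : ∀ A → g G A ≡ sumℚ (map (potential A) (vertices G))
  g≡sum-potential A = begin
    h G A + δ * (+ f G A / 1)
      ≡⟨ cong₂ (λ s t → s + δ * t) (sum-map-cong (vertices G) (λ {v} _ → hv≡influence A v))
                                   (length-filter≡sum (λ v → covered A v Bool.≟ true) (vertices G)) ⟩
    sumℚ (map (influence A) (vertices G)) + δ * sumℚ (map (λ v → indicator (covered A v)) (vertices G))
      ≡⟨ cong (λ t → sumℚ (map (influence A) (vertices G)) + t) (sum-map-*ˡ δ _ (vertices G)) ⟨
    sumℚ (map (influence A) (vertices G)) + sumℚ (map (λ v → δ * indicator (covered A v)) (vertices G))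
      ≡⟨ sum-map-+ (influence A) _ (vertices G) ⟨
    sumℚ (map (potential A) (vertices G)) ∎
    where open ≡-Reasoning

  vertex-gain : Subset n → Fin n → Fin n → ℚ
  vertex-gain A x v = influence-gain A x v + δ * coverage-gain A x v

  gain≡sum-vertex-gain : ∀ A x → gain G A x ≡ sumℚ (map (vertex-gain A x) (vertices G))
  gain≡sum-vertex-gain A x = begin
    g G (A ∪ ⁅ x ⁆) - g G A
      ≡⟨ cong₂ _-_ (g≡sum-potential (A ∪ ⁅ x ⁆)) (g≡sum-potential A) ⟩
    sumℚ (map (potential (A ∪ ⁅ x ⁆)) (vertices G)) - sumℚ (map (potential A) (vertices G))
      ≡⟨ sum-map-- (potential (A ∪ ⁅ x ⁆)) (potential A) (vertices G) ⟨
    sumℚ (map (λ v → potential (A ∪ ⁅ x ⁆) v - potential A v) (vertices G))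
      ≡⟨ sum-map-cong (vertices G) (λ {v} _ →
           solve 5 (λ a b d p q → (a :+ d :* p) :- (b :+ d :* q) := (a :- b) :+ d :* (p :- q)) refl
             (influence (A ∪ ⁅ x ⁆) v) (influence A v) δ
             (indicator (covered (A ∪ ⁅ x ⁆) v)) (indicator (covered A v))) ⟩
    sumℚ (map (vertex-gain A x) (vertices G)) ∎
    where open ≡-Reasoning

  vertex-gain-nonNeg : ∀ A x v → 0ℚ ≤ vertex-gain A x v
  vertex-gain-nonNeg A x v =
    ℚₚ.+-mono-≤ (influence-gain-nonNeg A x v) (0≤p*q 0≤δ (coverage-gain-nonNeg A x v))

  influence-gain≤vertex-gain : ∀ A x v → influence-gain A x v ≤ vertex-gain A x v
  influence-gain≤vertex-gain A x v = p≤p+q (0≤p*q 0≤δ (coverage-gain-nonNeg A x v))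

  vertex-gain≤gain : ∀ A x v → vertex-gain A x v ≤ gain G A x
  vertex-gain≤gain A x v = subst (vertex-gain A x v ≤_) (sym (gain≡sum-vertex-gain A x))
    (term≤sum-map (vertices G) (λ {u} _ → vertex-gain-nonNeg A x u) (∈-allFin v))

  g-mono : ∀ {A B} → A ⊆ B → g G A ≤ g G B
  g-mono {A} {B} A⊆B = subst₂ _≤_ (sym (g≡sum-potential A)) (sym (g≡sum-potential B))
    (sum-map-mono (vertices G) (λ {v} _ → ℚₚ.+-mono-≤ (influence-mono A⊆B v)
      (*-monoˡ-≤-0≤ 0≤δ (indicator-mono (covered-mono A⊆B)))))

  gain-antitone : ∀ {A B} x → A ⊆ B → gain G B x ≤ gain G A x
  gain-antitone {A} {B} x A⊆B = subst₂ _≤_ (sym (gain≡sum-vertex-gain B x)) (sym (gain≡sum-vertex-gain A x))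
    (sum-map-mono (vertices G) (λ {v} _ → ℚₚ.+-mono-≤ (influence-gain-antitone A⊆B x v)
      (*-monoˡ-≤-0≤ 0≤δ (coverage-gain-antitone A⊆B x v))))

  lv≢0 : ∀ v → lv G v ≢ 0
  lv≢0 v = lcm≢0 (λ ()) (foldr-lcm-↧≢0 (w v) (nbrs G v))

  lv≤L : ∀ v → lv G v ℕ.≤ L G
  lv≤L v = ≤foldr-⊔ (lv G) (∈-allFin v)

  -- l(v) is a common denominator of W(v)/2 and the weights at v, hence of every h_A(v).
  W/2-onGrid : ∀ v → OnGrid (lv G v) (W/2 v)
  W/2-onGrid v = ↧∣⇒onGrid (W/2 v) (m∣lcm[m,n] (↧ₙ W/2 v) (foldr lcm 1 (map (λ u → ↧ₙ w v u) (nbrs G v))))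

  w-onGrid : ∀ {v u} → u ∈ˡ nbrs G v → OnGrid (lv G v) (w v u)
  w-onGrid {v} {u} u∈ = ↧∣⇒onGrid (w v u)
    (∣-trans (↧∣foldr-lcm (w v) u∈) (n∣lcm[m,n] (↧ₙ W/2 v) (foldr lcm 1 (map (λ u → ↧ₙ w v u) (nbrs G v)))))

  influence-onGrid : ∀ A v → OnGrid (lv G v) (influence A v)
  influence-onGrid A v = onGrid-if-else (lookup A v) (W/2-onGrid v)
    (onGrid-⊓ (W/2-onGrid v) (onGrid-sum (nbrs G v) λ {u} u∈ → onGrid-if (lookup A u) (w-onGrid u∈)))

  recipℕ-antitone : ∀ {k m} → suc k ℕ.≤ m → recipℕ G m ≤ + 1 / suc k
  recipℕ-antitone {k} {suc ℓ} k<m = /-≤ (+ 1) (+ 1) ℓ k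
    (subst₂ ℤ._≤_ (sym (ℤₚ.*-identityˡ (+ suc k))) (sym (ℤₚ.*-identityˡ (+ suc ℓ))) (ℤ.+≤+ k<m))

  influence-gain-granular : ∀ A x v → Granular δ (influence-gain A x v)
  influence-gain-granular A x v =
    granular-mono (recipℕ-antitone (subst (ℕ._≤ L G) lv≡ (lv≤L v)))
      (onGrid-granular (subst (λ l → OnGrid l (influence A v)) lv≡ (influence-onGrid A v))
                       (subst (λ l → OnGrid l (influence (A ∪ ⁅ x ⁆) v)) lv≡ (influence-onGrid (A ∪ ⁅ x ⁆) v)))
    where lv≡ = sym (ℕₚ.suc-pred (lv G v) {{ℕ.≢-nonZero (lv≢0 v)}})

  vertex-gain-granular : ∀ A x v → Granular δ (vertex-gain A x v)
  vertex-gain-granular A x v = granular-+ (influence-gain-nonNeg A x v) (0≤p*q 0≤δ (coverage-gain-nonNeg A x v))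
    (influence-gain-granular A x v) (*-01-granular (coverage-gain-01 A x v))

  gain-granular : ∀ A x → 0ℚ < gain G A x → δ ≤ gain G A x
  gain-granular A x 0<gain = granular-pos 0<gain (subst (Granular δ) (sym (gain≡sum-vertex-gain A x))
    (sum-map-granular (vertices G) (vertex-gain-nonNeg A x) (vertex-gain-granular A x)))

  recipℕ-pos : ∀ {m} → m ≢ 0 → 0ℚ < recipℕ G m
  recipℕ-pos {zero}  m≢0 = contradiction refl m≢0
  recipℕ-pos {suc ℓ} _   = 1/suc-pos ℓ

  ℕ/1*recipℕ≡1 : ∀ {m} → m ≢ 0 → (+ m / 1) * recipℕ G m ≡ 1ℚ
  ℕ/1*recipℕ≡1 {zero}  m≢0 = contradiction refl m≢0
  ℕ/1*recipℕ≡1 {suc ℓ} _   = suc/1*1/suc≡1 ℓ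

  L≢0 : Fin n → L G ≢ 0
  L≢0 v L≡0 = lv≢0 v (ℕₚ.n≤0⇒n≡0 (subst (lv G v ℕ.≤_) L≡0 (lv≤L v)))

  0<δ : Fin n → 0ℚ < δ
  0<δ v = recipℕ-pos (L≢0 v)

  vertex-gain-covers : ∀ {A x v} → covered A v ≡ false → adj v x ≡ true → δ ≤ vertex-gain A x v
  vertex-gain-covers {A} {x} {v} uncov vx = begin
    δ                                    ≡⟨ ℚₚ.*-identityʳ δ ⟨
    δ * 1ℚ                               ≡⟨ cong₂ (λ a b → δ * (indicator a - indicator b)) (adj⇒covered {A} vx) uncov ⟨
    δ * coverage-gain A x v              ≡⟨ ℚₚ.+-identityˡ _ ⟨
    0ℚ + δ * coverage-gain A x v         ≤⟨ ℚₚ.+-monoˡ-≤ _ (influence-gain-nonNeg A x v) ⟩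
    vertex-gain A x v                    ∎
    where open ℚₚ.≤-Reasoning

  WA-⊥∪⁅x⁆ : ∀ x v → WA G (⊥ ∪ ⁅ x ⁆) v ≡ (if does (adj v x Bool.≟ true) then w v x else 0ℚ)
  WA-⊥∪⁅x⁆ x v = begin
    sumℚ (map (edge (⊥ ∪ ⁅ x ⁆) v) (nbrs G v))
      ≡⟨ sum-map-filter vx? (edge (⊥ ∪ ⁅ x ⁆) v) (allFin n) ⟩
    sumℚ (map (λ u → if does (vx? u) then edge (⊥ ∪ ⁅ x ⁆) v u else 0ℚ) (allFin n))
      ≡⟨ sum-map-cong (allFin n) (λ {u} _ → trans
           (cong (λ b → if does (vx? u) then (if b then w v u else 0ℚ) else 0ℚ) (lookup-⊥∪⁅x⁆ u))
           (if-swap (does (vx? u)) (does (u Fin.≟ x)) (w v u))) ⟩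
    sumℚ (map (λ u → if does (u Fin.≟ x) then (if does (vx? u) then w v u else 0ℚ) else 0ℚ) (allFin n))
      ≡⟨ sum-map-indicator Fin._≟_ (λ u → if does (vx? u) then w v u else 0ℚ) (allFin n) (allFin⁺ n) (∈-allFin x) ⟩
    (if does (vx? x) then w v x else 0ℚ) ∎
    where
    open ≡-Reasoning
    vx? = λ u → adj v u Bool.≟ true
    lookup-⊥∪⁅x⁆ : ∀ u → lookup (⊥ ∪ ⁅ x ⁆) u ≡ does (u Fin.≟ x)
    lookup-⊥∪⁅x⁆ u = trans (cong (λ p → lookup p u) (Subsetₚ.∪-identityˡ ⁅ x ⁆)) (lookup-⁅⁆ x u)

  influence-gain-⊥≤ : ∀ x v → influence-gain ⊥ x v ≤
                      (if does (v Fin.≟ x) then W/2 v else 0ℚ) + (if does (adj v x Bool.≟ true) then w v x else 0ℚ)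
  influence-gain-⊥≤ x v with position ⊥ x v
  ... | old v∈⊥ = contradiction v∈⊥ Subsetₚ.∉⊥
  ... | new v∉⊥ refl = begin
    influence-gain ⊥ v v       ≡⟨ influence-gain-new v∉⊥ ⟩
    W/2 v - W/2 v ⊓ WA G ⊥ v   ≤⟨ p-q≤p (ℚₚ.⊓-glb (W/2-nonNeg v) (WA-nonNeg ⊥ v)) ⟩
    W/2 v                      ≡⟨ ℚₚ.+-identityʳ (W/2 v) ⟨
    W/2 v + 0ℚ                 ≡⟨ cong (λ b → W/2 v + (if does (b Bool.≟ true) then w v v else 0ℚ)) (adj-irr v) ⟨
    W/2 v + wᵥᵥ                ≡⟨ cong (λ b → (if b then W/2 v else 0ℚ) + wᵥᵥ) (dec-true (v Fin.≟ v) refl) ⟨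
    (if does (v Fin.≟ v) then W/2 v else 0ℚ) + wᵥᵥ ∎
    where
    open ℚₚ.≤-Reasoning
    wᵥᵥ = if does (adj v v Bool.≟ true) then w v v else 0ℚ
  ... | untouched v∉⊥ v≢x = begin
    influence-gain ⊥ x v                              ≡⟨ influence-gain-untouched v∉⊥ v≢x ⟩
    W/2 v ⊓ WA G (⊥ ∪ ⁅ x ⁆) v - W/2 v ⊓ WA G ⊥ v     ≤⟨ ℚₚ.≤-trans (p-q≤p (ℚₚ.⊓-glb (W/2-nonNeg v) (WA-nonNeg ⊥ v)))
                                                                   (ℚₚ.p⊓q≤q (W/2 v) _) ⟩
    WA G (⊥ ∪ ⁅ x ⁆) v                                ≡⟨ WA-⊥∪⁅x⁆ x v ⟩
    wᵥₓ                                               ≡⟨ ℚₚ.+-identityˡ wᵥₓ ⟨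
    0ℚ + wᵥₓ                                          ≡⟨ cong (λ b → (if b then W/2 v else 0ℚ) + wᵥₓ)
                                                              (dec-false (v Fin.≟ x) v≢x) ⟨
    (if does (v Fin.≟ x) then W/2 v else 0ℚ) + wᵥₓ    ∎
    where
    open ℚₚ.≤-Reasoning
    wᵥₓ = if does (adj v x Bool.≟ true) then w v x else 0ℚ

  covered-⊥ : ∀ v → covered ⊥ v ≡ false
  covered-⊥ v with covered ⊥ v in cov
  ... | true  = contradiction (proj₂ (proj₂ (covered⇒∈ cov))) Subsetₚ.∉⊥
  ... | false = refl

  coverage-gain-⊥≤ : ∀ x v → coverage-gain ⊥ x v ≤ indicator (adj v x)
  coverage-gain-⊥≤ x v = begin
    indicator c - indicator (covered ⊥ v)  ≡⟨ cong (λ b → indicator c - indicator b) (covered-⊥ v) ⟩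
    indicator c - 0ℚ                       ≡⟨ ℚₚ.+-identityʳ (indicator c) ⟩
    indicator c                            ≤⟨ indicator-mono (λ cov → newly-covered⇒adj {⊥} cov (covered-⊥ v)) ⟩
    indicator (adj v x)                    ∎
    where
    open ℚₚ.≤-Reasoning
    c = covered (⊥ ∪ ⁅ x ⁆) v

  -- A single vertex x only influences itself (by at most W(x)/2) and its neighbours.
  singleton-bound : Fin n → Fin n → ℚ
  singleton-bound x v = (if does (v Fin.≟ x) then W/2 v else 0ℚ)
                      + (if does (adj v x Bool.≟ true) then w v x else 0ℚ)
                      + δ * indicator (adj v x)

  sum-singleton-bound : ∀ x → sumℚ (map (singleton-bound x) (vertices G)) ≡ W/2 x + Wv G x + δ * (+ deg G x / 1)
  sum-singleton-bound x = begin
    sumℚ (map (singleton-bound x) (vertices G))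
      ≡⟨ sum-map-+ (λ v → self v + nbr v) (λ v → δ * indicator (adj v x)) (vertices G) ⟩
    sumℚ (map (λ v → self v + nbr v) (vertices G)) + sumℚ (map (λ v → δ * indicator (adj v x)) (vertices G))
      ≡⟨ cong₂ _+_ (sum-map-+ self nbr (vertices G)) (sum-map-*ˡ δ (λ v → indicator (adj v x)) (vertices G)) ⟩
    sumℚ (map self (vertices G)) + sumℚ (map nbr (vertices G)) + δ * sumℚ (map (λ v → indicator (adj v x)) (vertices G))
      ≡⟨ cong₂ (λ a b → a + δ * b) (cong₂ _+_ self-sum nbr-sum) deg-sum ⟩
    W/2 x + Wv G x + δ * (+ deg G x / 1) ∎
    where
    open ≡-Reasoning
    self nbr : Fin n → ℚ
    self v = if does (v Fin.≟ x) then W/2 v else 0ℚ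
    nbr  v = if does (adj v x Bool.≟ true) then w v x else 0ℚ
    self-sum : sumℚ (map self (vertices G)) ≡ W/2 x
    self-sum = sum-map-indicator Fin._≟_ W/2 (allFin n) (allFin⁺ n) (∈-allFin x)
    nbr-sum : sumℚ (map nbr (vertices G)) ≡ Wv G x
    nbr-sum = trans (sum-map-cong (vertices G) λ {v} _ →
                      cong₂ (λ b t → if does (b Bool.≟ true) then t else 0ℚ) (adj-sym v x) (w-sym v x))
                    (sym (sum-map-filter (λ v → adj x v Bool.≟ true) (w x) (allFin n)))
    deg-sum : sumℚ (map (λ v → indicator (adj v x)) (vertices G)) ≡ + deg G x / 1
    deg-sum = trans (sum-map-cong (vertices G) λ {v} _ → cong indicator (adj-sym v x))
                    (sym (length-filter≡sum (λ v → adj x v Bool.≟ true) (allFin n)))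

  gain-⊥≤ : ∀ x → gain G ⊥ x ≤ Xbound G * δ
  gain-⊥≤ x = begin
    gain G ⊥ x
      ≡⟨ gain≡sum-vertex-gain ⊥ x ⟩
    sumℚ (map (vertex-gain ⊥ x) (vertices G))
      ≤⟨ sum-map-mono (vertices G) (λ {v} _ →
           ℚₚ.+-mono-≤ (influence-gain-⊥≤ x v) (*-monoˡ-≤-0≤ 0≤δ (coverage-gain-⊥≤ x v))) ⟩
    sumℚ (map (singleton-bound x) (vertices G))
      ≡⟨ sum-singleton-bound x ⟩
    W/2 x + Wv G x + δ * (+ deg G x / 1)
      ≡⟨ cong (_+ δ * (+ deg G x / 1)) (solve 1 (λ W → con ½ :* W :+ W := con (+ 3 / 2) :* W) refl (Wv G x)) ⟩
    (+ 3 / 2) * Wv G x + δ * (+ deg G x / 1)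
      ≤⟨ ℚₚ.+-mono-≤ (*-monoˡ-≤-0≤ {+ 3 / 2} (ℚₚ.≤ᵇ⇒≤ _) (≤foldr-⊔ℚ (Wv G) (∈-allFin x)))
                     (*-monoˡ-≤-0≤ 0≤δ (ℕ/1-mono-≤ (≤foldr-⊔ (deg G) (∈-allFin x)))) ⟩
    (+ 3 / 2) * Wmax G + δ * (+ Δ G / 1)
      ≡⟨ trans (cong (λ z → (+ 3 / 2) * Wmax G * z + δ * (+ Δ G / 1)) (ℕ/1*recipℕ≡1 (L≢0 x)))
               (cong (_+ δ * (+ Δ G / 1)) (ℚₚ.*-identityʳ ((+ 3 / 2) * Wmax G))) ⟨
    (+ 3 / 2) * Wmax G * ((+ L G / 1) * δ) + δ * (+ Δ G / 1)
      ≡⟨ solve 5 (λ a W K d D → a :* W :* (K :* d) :+ d :* D := (a :* (K :* W) :+ D) :* d)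
           refl (+ 3 / 2) (Wmax G) (+ L G / 1) δ (+ Δ G / 1) ⟩
    Xbound G * δ ∎
    where open ℚₚ.≤-Reasoning

  module _ (no-isolated : NoIsolated G) where

    0<W/2 : ∀ v → 0ℚ < W/2 v
    0<W/2 v with no-isolated v
    ... | u , vu = ℚₚ.*-monoʳ-<-pos ½ (ℚₚ.<-≤-trans (nbr⇒0<w (adj⇒nbr vu))
                     (term≤sum-map (nbrs G v) (λ u∈ → ℚₚ.<⇒≤ (nbr⇒0<w u∈)) (adj⇒nbr vu)))

    feasible⇒covered : ∀ {T} → IsWPPITDS G T → ∀ v → covered T v ≡ true
    feasible⇒covered {T} (dominated , total) v with v Subsetₚ.∈? T
    ... | yes v∈T = let (u , vu , u∈T) = total v v∈T in ∈⇒covered (adj⇒nbr vu) u∈T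
    ... | no  v∉T with covered T v in cov
    ...   | true  = refl
    ...   | false = contradiction
      (ℚₚ.<-≤-trans (0<W/2 v) (subst (W/2 v ≤_) (uncovered⇒WA≡0 {T} cov) (dominated v v∉T)))
      (ℚₚ.<-irrefl refl)

    feasible⇒influence≡W/2 : ∀ {T} → IsWPPITDS G T → ∀ v → influence T v ≡ W/2 v
    feasible⇒influence≡W/2 {T} (dominated , _) v with v Subsetₚ.∈? T
    ... | yes v∈T = influence-∈ v∈T
    ... | no  v∉T = trans (influence-∉ v∉T) (ℚₚ.p≤q⇒p⊓q≡p (dominated v v∉T))

    -- Every vertex contributes at most W(v)/2 + 1/L to g, with equality on feasible sets.
    g-max : ℚ
    g-max = sumℚ (map (λ v → W/2 v + δ) (vertices G))

    g≤g-max : ∀ A → g G A ≤ g-max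
    g≤g-max A = subst (_≤ g-max) (sym (g≡sum-potential A)) (sum-map-mono (vertices G) λ {v} _ →
      ℚₚ.+-mono-≤ (influence≤W/2 A v)
        (subst (δ * indicator (covered A v) ≤_) (ℚₚ.*-identityʳ δ) (*-monoˡ-≤-0≤ 0≤δ (indicator≤1 (covered A v)))))

    feasible⇒g-max≤g : ∀ T → IsWPPITDS G T → g-max ≤ g G T
    feasible⇒g-max≤g T T-feasible = ℚₚ.≤-reflexive (trans (sum-map-cong (vertices G) λ {v} _ →
      trans (cong (λ d → W/2 v + d) (sym (ℚₚ.*-identityʳ δ)))
            (cong₂ (λ a b → a + δ * indicator b) (sym (feasible⇒influence≡W/2 T-feasible v))
                                                 (sym (feasible⇒covered T-feasible v))))
      (sym (g≡sum-potential T)))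

    module _ (S : Subset n) (stuck : ∀ u → u ∉ S → gain G S u ≤ 0ℚ) where

      private
        vertex-gain≤0 : ∀ {u} → u ∉ S → ∀ v → vertex-gain S u v ≤ 0ℚ
        vertex-gain≤0 {u} u∉S v = ℚₚ.≤-trans (vertex-gain≤gain S u v) (stuck u u∉S)

      -- An underdominated v ∉ S would gain W(v)/2 - W_S(v) > 0 by adding v itself.
      stuck⇒dominated : ∀ v → v ∉ S → W/2 v ≤ WA G S v
      stuck⇒dominated v v∉S = by-cases (W/2 v ℚₚ.≤? WA G S v)
        where
        by-cases : Dec (W/2 v ≤ WA G S v) → W/2 v ≤ WA G S v
        by-cases (yes dominated) = dominated
        by-cases (no  W/2≰WA)    = contradiction (ℚₚ.<-≤-trans 0<gain (vertex-gain≤0 v∉S v)) (ℚₚ.<-irrefl refl)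
          where
          WA<W/2 = ℚₚ.≰⇒> W/2≰WA
          0<influence-gain : 0ℚ < influence-gain S v v
          0<influence-gain = subst (0ℚ <_)
            (sym (trans (influence-gain-new v∉S) (cong (λ t → W/2 v - t) (ℚₚ.p≥q⇒p⊓q≡q (ℚₚ.<⇒≤ WA<W/2)))))
            (p<q⇒0<q-p WA<W/2)
          0<gain : 0ℚ < vertex-gain S v v
          0<gain = ℚₚ.<-≤-trans 0<influence-gain (influence-gain≤vertex-gain S v v)

      -- An uncovered v would gain 1/L by adding any of its (necessarily outside) neighbours.
      stuck⇒total : ∀ v → Σ (Fin n) λ u → adj v u ≡ true × u ∈ S
      stuck⇒total v = by-cases (covered S v) refl
        where
        by-cases : ∀ b → covered S v ≡ b → Σ (Fin n) λ u → adj v u ≡ true × u ∈ S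
        by-cases true  cov = let (u , u∈ , u∈S) = covered⇒∈ cov in u , nbr⇒adj u∈ , u∈S
        by-cases false cov = contradiction
          (ℚₚ.<-≤-trans (0<δ v) (ℚₚ.≤-trans (vertex-gain-covers {S} cov vu) (vertex-gain≤0 u∉S v)))
          (ℚₚ.<-irrefl refl)
          where
          u = proj₁ (no-isolated v)
          vu = proj₂ (no-isolated v)
          u∉S : u ∉ S
          u∉S u∈S = contradiction (trans (sym (∈⇒covered (adj⇒nbr vu) u∈S)) cov) λ ()

      stuck⇒feasible : IsWPPITDS G S
      stuck⇒feasible = stuck⇒dominated , λ v _ → stuck⇒total v

    ∣feasible∣≡suc : ∀ {T} → IsWPPITDS G T → Fin n → Σ ℕ λ r → ∣ T ∣ ≡ suc r
    ∣feasible∣≡suc {T} T-feasible v = ℕ.pred ∣ T ∣ , sym (ℕₚ.suc-pred ∣ T ∣ {{ℕ.>-nonZero 0<∣T∣}})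
      where
      u = proj₁ (covered⇒∈ {T} (feasible⇒covered T-feasible v))
      u∈T = proj₂ (proj₂ (covered⇒∈ {T} (feasible⇒covered T-feasible v)))
      0<∣T∣ : 0 ℕ.< ∣ T ∣
      0<∣T∣ = subst (ℕ._≤ ∣ T ∣) (Subsetₚ.∣⁅x⁆∣≡1 u)
                (Subsetₚ.p⊆q⇒∣p∣≤∣q∣ (λ y∈ → subst (_∈ T) (sym (Subsetₚ.x∈⁅y⁆⇒x≡y u y∈)) u∈T))

    1≤Xbound : Fin n → 1ℚ ≤ Xbound G
    1≤Xbound v = ℚₚ.≤-trans (ℕ/1-mono-≤ 1≤Δ)
      (subst (_≤ Xbound G) (ℚₚ.+-identityˡ (+ Δ G / 1)) (ℚₚ.+-monoˡ-≤ (+ Δ G / 1)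
        (0≤p*q {+ 3 / 2} (ℚₚ.≤ᵇ⇒≤ _) (0≤p*q (ℕ/1-mono-≤ {0} {L G} ℕ.z≤n)
          (ℚₚ.≤-trans (Wv-nonNeg v) (≤foldr-⊔ℚ (Wv G) (∈-allFin v)))))))
      where
      1≤Δ : 1 ℕ.≤ Δ G
      1≤Δ = ℕₚ.≤-trans (∈⇒0<length (adj⇒nbr (proj₂ (no-isolated v)))) (≤foldr-⊔ (deg G) (∈-allFin v))

theorem7 : (m : ℕ) (G : WGraph (suc m)) → NoIsolated G →
    (S : Subset (suc m)) → GreedyOutput G S →
    IsWPPITDS G S ×
    ((Sstar : Subset (suc m)) → IsMinWPPITDS G Sstar → LnBound ∣ S ∣ ∣ Sstar ∣ (Xbound G))
theorem7 m G no-isolated S (S-reach , stuck) = stuck⇒feasible G no-isolated S stuck , ln-bound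
  where
  open GreedyAnalysis G (0<δ G zero) (1≤Xbound G no-isolated zero) (g-mono G) (gain-antitone G)
                        (gain-granular G) (gain-⊥≤ G) (g≤g-max G no-isolated) (feasible⇒g-max≤g G no-isolated)
  ln-bound : ∀ S* → IsMinWPPITDS G S* → LnBound ∣ S ∣ ∣ S* ∣ (Xbound G)
  ln-bound S* (S*-feasible , _) =
    let (r , ∣S*∣≡) = ∣feasible∣≡suc G no-isolated S*-feasible zero
    in subst (λ k → LnBound ∣ S ∣ k (Xbound G)) (sym ∣S*∣≡) (greedy-bound S* r ∣S*∣≡ S*-feasible S-reach)
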